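{- Let $(\mathcal B,\otimes,I)$ be a cartesian bicategory. Then the functor $\mathcal R(\mathcal B)=\mathrm{Hom}_{\mathcal B}(-,I)\colon \mathrm{Map}(\mathcal B)^{op}\to\mathbf{InfSL}$ is an elementary existential doctrine.
   Context: Composition is written diagrammatically as $f;g$ (first $f$, then $g$). A cartesian bicategory is a symmetric monoidal category $(\mathcal B,\otimes,I)$ enriched in posets (each hom-set is a partial order and both composition and $\otimes$ are monotone), in which every object $X$ is equipped with morphisms $d_X\colon X\to X\otimes X$ and $e_X\colon X\to I$ such that: (1) $(d_X,e_X)$ is a cocommutative comonoid; (2) $d_X$ and $e_X$ have right adjoints $d_X^*\colon X\otimes X\to X$ and $e_X^*\colon I\to X$, i.e. $\mathrm{id}_X\le d_X;d_X^*$, $d_X^*;d_X\le\mathrm{id}_{X\otimes X}$, $\mathrm{id}_X\le e_X;e_X^*$, $e_X^*;e_X\le\mathrm{id}_I$; (3) the Frobenius law $(d_X\otimes\mathrm{id}_X);(\mathrm{id}_X\otimes d_X^*)=d_X^*;d_X$ holds; (4) every morphism $R\colon X\to Y$ is a lax comonoid homomorphism: $R;d_Y\le d_X;(R\otimes R)$ and $R;e_Y\le e_X$; (5) the comonoids are coherent with the monoidal structure: $e_{X\otimes Y}=e_X\otimes e_Y$ and $d_{X\otimes Y}=(d_X\otimes d_Y);(\mathrm{id}_X\otimes\sigma_{X,Y}\otimes\mathrm{id}_Y)$ (modulo the coherence isomorphisms, including $I\otimes I\cong I$), with $d_I,e_I$ the canonical isomorphisms. A map is a morphism $f\colon X\to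 Y$ with $f;d_Y=d_X;(f\otimes f)$ and $f;e_Y=e_X$; maps form a subcategory $\mathrm{Map}(\mathcal B)$, which is a cartesian category (chosen finite products) with product $\otimes$, terminal object $I$, diagonals $d_X$ and terminal maps $e_X$. Each $\mathrm{Hom}_{\mathcal B}(X,I)$ is a meet-semilattice with top $e_X$ and meet $R\wedge S=d_X;(R\otimes S)$ (followed by $I\otimes I\cong I$), and for a map $f\colon X\to Y$ the function $U\mapsto f;U$ preserves finite meets; $\mathcal R(\mathcal B)$ sends $X$ to $\mathrm{Hom}_{\mathcal B}(X,I)$ and a map $f\colon X\to Y$ to $U\mapsto f;U$. $\mathbf{InfSL}$ is the category of meet-semilattices with top and maps preserving finite meets and top. Elementary existential doctrine: let $\mathcal C$ be a cartesian category with chosen products $\times$, projections $\pi_i$, pairing $\langle-,-\rangle$, terminal object $I$ and diagonals $\Delta_A=\langle\mathrm{id},\mathrm{id}\rangle$. A functor $P\colon\mathcal C^{op}\to\mathbf{InfSL}$ (write $P_f$ for $P(f)$) is an elementary existential doctrine if: (Elementary) for every object $A$ there is $\delta_A\in P(A\times A)$ such that for every $X$ and $e=\mathrm{id}_X\times\Delta_A\colon X\times A\to X\times A\times A$, the map $P_e$ has a left adjoint $\exists_e$ given by $\exists_e(\alpha)=P_{\langle\pi_1,\pi_2\rangle}(\alpha)\wedge P_{\langle\pi_2,\pi_3\rangle}(\delta_A)$; (Existential) for every projection $\pi_i\colon A_1\times A_2\to A_i$, $P_{\pi_i}$ has a left adjoint $\exists_{\pi_i}$ such that (Beck–Chevalley)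 for any projection $\pi\colon X\times A\to A$ and any pullback square with $f'\colon X'\to X\times A$, $\pi'\colon X'\to A'$, $f\colon A'\to A$, $\pi f'=f\pi'$, one has $\exists_{\pi'}(P_{f'}(\beta))=P_f(\exists_\pi(\beta))$ for all $\beta\in P(X\times A)$, and (Frobenius reciprocity) $\exists_\pi(P_\pi(\alpha)\wedge\beta)=\alpha\wedge\exists_\pi(\beta)$ for all $\alpha\in P(A)$, $\beta\in P(X\times A)$. -}

module Defs where

open import Level using (Level; _⊔_) renaming (suc to lsuc)
open import Relation.Binary.PropositionalEquality using (_≡_)
open import Data.Product using (Σ; _×_)
open import Function.Bundles using (_⇔_)

-- Cartesian bicategories (Carboni–Walters), composition written
-- diagrammatically:  f ⨾ g  = "first f, then g".

record CartesianBicategory (o ℓ r : Level) : Set (lsuc (o ⊔ ℓ ⊔ r)) where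
  infixr 9 _⨾_
  infixr 10 _⊗₁_
  infixr 10 _⊗₀_
  infix 4 _≤_
  field
    Obj : Set o
    Hom : Obj → Obj → Set ℓ
    id  : ∀ {X} → Hom X X
    _⨾_ : ∀ {X Y Z} → Hom X Y → Hom Y Z → Hom X Z
    ⨾-identityˡ : ∀ {X Y} (f : Hom X Y) → id ⨾ f ≡ f
    ⨾-identityʳ : ∀ {X Y} (f : Hom X Y) → f ⨾ id ≡ f
    ⨾-assoc : ∀ {W X Y Z} (f : Hom W X) (g : Hom X Y) (h : Hom Y Z) →
              (f ⨾ g) ⨾ h ≡ f ⨾ (g ⨾ h)

    _≤_ : ∀ {X Y} → Hom X Y → Hom X Y → Set r
    ≤-refl    : ∀ {X Y} {f : Hom X Y} → f ≤ f
    ≤-trans   : ∀ {X Y} {f g h : Hom X Y} → f ≤ g → g ≤ h → f ≤ h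
    ≤-antisym : ∀ {X Y} {f g : Hom X Y} → f ≤ g → g ≤ f → f ≡ g
    ⨾-mono : ∀ {X Y Z} {f f' : Hom X Y} {g g' : Hom Y Z} →
             f ≤ f' → g ≤ g' → f ⨾ g ≤ f' ⨾ g'

    _⊗₀_ : Obj → Obj → Obj
    _⊗₁_ : ∀ {A B C D} → Hom A B → Hom C D → Hom (A ⊗₀ C) (B ⊗₀ D)
    ⊗-identity : ∀ {X Y} → id {X} ⊗₁ id {Y} ≡ id
    ⊗-homo : ∀ {A B C D E F} (f : Hom A B) (g : Hom B C) (h : Hom D E) (k : Hom E F) →
             (f ⨾ g) ⊗₁ (h ⨾ k) ≡ (f ⊗₁ h) ⨾ (g ⊗₁ k)
    ⊗-mono : ∀ {A B C D} {f f' : Hom A B} {g g' : Hom C D} →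
             f ≤ f' → g ≤ g' → f ⊗₁ g ≤ f' ⊗₁ g'
    I : Obj

    assoc⇒ : ∀ {X Y Z} → Hom ((X ⊗₀ Y) ⊗₀ Z) (X ⊗₀ (Y ⊗₀ Z))
    assoc⇐ : ∀ {X Y Z} → Hom (X ⊗₀ (Y ⊗₀ Z)) ((X ⊗₀ Y) ⊗₀ Z)
    assoc-isoˡ : ∀ {X Y Z} → assoc⇒ {X} {Y} {Z} ⨾ assoc⇐ ≡ id
    assoc-isoʳ : ∀ {X Y Z} → assoc⇐ {X} {Y} {Z} ⨾ assoc⇒ ≡ id
    assoc-natural : ∀ {A B C D E F} (f : Hom A B) (g : Hom C D) (h : Hom E F) →
                    ((f ⊗₁ g) ⊗₁ h) ⨾ assoc⇒ ≡ assoc⇒ ⨾ (f ⊗₁ (g ⊗₁ h))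

    unitˡ⇒ : ∀ {X} → Hom (I ⊗₀ X) X
    unitˡ⇐ : ∀ {X} → Hom X (I ⊗₀ X)
    unitˡ-isoˡ : ∀ {X} → unitˡ⇒ {X} ⨾ unitˡ⇐ ≡ id
    unitˡ-isoʳ : ∀ {X} → unitˡ⇐ {X} ⨾ unitˡ⇒ ≡ id
    unitˡ-natural : ∀ {A B} (f : Hom A B) → (id {I} ⊗₁ f) ⨾ unitˡ⇒ ≡ unitˡ⇒ ⨾ f

    unitʳ⇒ : ∀ {X} → Hom (X ⊗₀ I) X
    unitʳ⇐ : ∀ {X} → Hom X (X ⊗₀ I)
    unitʳ-isoˡ : ∀ {X} → unitʳ⇒ {X} ⨾ unitʳ⇐ ≡ id
    unitʳ-isoʳ : ∀ {X} → unitʳ⇐ {X} ⨾ unitʳ⇒ ≡ id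
    unitʳ-natural : ∀ {A B} (f : Hom A B) → (f ⊗₁ id {I}) ⨾ unitʳ⇒ ≡ unitʳ⇒ ⨾ f

    σ : ∀ {X Y} → Hom (X ⊗₀ Y) (Y ⊗₀ X)
    σ-involutive : ∀ {X Y} → σ {X} {Y} ⨾ σ {Y} {X} ≡ id
    σ-natural : ∀ {A B C D} (f : Hom A B) (g : Hom C D) →
                (f ⊗₁ g) ⨾ σ ≡ σ ⨾ (g ⊗₁ f)

    pentagon : ∀ {W X Y Z} →
      (assoc⇒ {W} {X} {Y} ⊗₁ id {Z}) ⨾ assoc⇒ {W} {X ⊗₀ Y} {Z} ⨾ (id {W} ⊗₁ assoc⇒ {X} {Y} {Z})
        ≡ assoc⇒ {W ⊗₀ X} {Y} {Z} ⨾ assoc⇒ {W} {X} {Y ⊗₀ Z}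
    triangle : ∀ {X Y} →
      assoc⇒ {X} {I} {Y} ⨾ (id {X} ⊗₁ unitˡ⇒ {Y}) ≡ unitʳ⇒ {X} ⊗₁ id {Y}
    hexagon : ∀ {X Y Z} →
      assoc⇒ {X} {Y} {Z} ⨾ σ {X} {Y ⊗₀ Z} ⨾ assoc⇒ {Y} {Z} {X}
        ≡ (σ {X} {Y} ⊗₁ id {Z}) ⨾ assoc⇒ {Y} {X} {Z} ⨾ (id {Y} ⊗₁ σ {X} {Z})

    d  : ∀ {X} → Hom X (X ⊗₀ X)
    e  : ∀ {X} → Hom X I
    d* : ∀ {X} → Hom (X ⊗₀ X) X
    e* : ∀ {X} → Hom I X

    d-coassoc : ∀ {X} →
      d {X} ⨾ (d {X} ⊗₁ id {X}) ⨾ assoc⇒ ≡ d {X} ⨾ (id {X} ⊗₁ d {X})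
    d-counitˡ : ∀ {X} → d {X} ⨾ (e {X} ⊗₁ id {X}) ⨾ unitˡ⇒ ≡ id
    d-counitʳ : ∀ {X} → d {X} ⨾ (id {X} ⊗₁ e {X}) ⨾ unitʳ⇒ ≡ id
    d-cocomm  : ∀ {X} → d {X} ⨾ σ {X} {X} ≡ d {X}

    d-unit   : ∀ {X} → id {X} ≤ d {X} ⨾ d* {X}
    d-counit : ∀ {X} → d* {X} ⨾ d {X} ≤ id {X ⊗₀ X}
    e-unit   : ∀ {X} → id {X} ≤ e {X} ⨾ e* {X}
    e-counit : ∀ {X} → e* {X} ⨾ e {X} ≤ id {I}

    frobenius : ∀ {X} →
      (d {X} ⊗₁ id {X}) ⨾ assoc⇒ {X} {X} {X} ⨾ (id {X} ⊗₁ d* {X}) ≡ d* {X} ⨾ d {X}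

    lax-d : ∀ {X Y} (R : Hom X Y) → R ⨾ d ≤ d ⨾ (R ⊗₁ R)
    lax-e : ∀ {X Y} (R : Hom X Y) → R ⨾ e ≤ e

    e-⊗ : ∀ {X Y} → e {X ⊗₀ Y} ≡ (e {X} ⊗₁ e {Y}) ⨾ unitˡ⇒ {I}
    d-⊗ : ∀ {X Y} →
      d {X ⊗₀ Y} ≡ (d {X} ⊗₁ d {Y})
                   ⨾ assoc⇒ {X} {X} {Y ⊗₀ Y}
                   ⨾ (id {X} ⊗₁ assoc⇐ {X} {Y} {Y})
                   ⨾ (id {X} ⊗₁ (σ {X} {Y} ⊗₁ id {Y}))
                   ⨾ (id {X} ⊗₁ assoc⇒ {Y} {X} {Y})
                   ⨾ assoc⇐ {X} {Y} {X ⊗₀ Y}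
    d-I : d {I} ≡ unitˡ⇐ {I}
    e-I : e {I} ≡ id {I}

module _ {o ℓ r : Level} (𝔹 : CartesianBicategory o ℓ r) where
  open CartesianBicategory 𝔹

  IsMap : ∀ {X Y} → Hom X Y → Set ℓ
  IsMap {X} {Y} f = (f ⨾ d {Y} ≡ d {X} ⨾ (f ⊗₁ f)) × (f ⨾ e {Y} ≡ e {X})

  -- chosen finite products of Map(B): product ⊗, terminal I,
  -- diagonals d, terminal maps e; projections and pairing derived
  π₁ : ∀ {X Y} → Hom (X ⊗₀ Y) X
  π₁ {X} {Y} = (id {X} ⊗₁ e {Y}) ⨾ unitʳ⇒

  π₂ : ∀ {X Y} → Hom (X ⊗₀ Y) Y
  π₂ {X} {Y} = (e {X} ⊗₁ id {Y}) ⨾ unitˡ⇒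

  ⟨_,_⟩ : ∀ {Z X Y} → Hom Z X → Hom Z Y → Hom Z (X ⊗₀ Y)
  ⟨ f , g ⟩ = d ⨾ (f ⊗₁ g)

  Δ : ∀ {X} → Hom X (X ⊗₀ X)
  Δ {X} = ⟨ id {X} , id {X} ⟩

  _×₁_ : ∀ {A B C D} → Hom A B → Hom C D → Hom (A ⊗₀ C) (B ⊗₀ D)
  f ×₁ g = ⟨ π₁ ⨾ f , π₂ ⨾ g ⟩

  Pred : Obj → Set ℓ
  Pred X = Hom X I

  ⊤ : ∀ {X} → Pred X
  ⊤ = e

  _∧_ : ∀ {X} → Pred X → Pred X → Pred X
  U ∧ V = d ⨾ (U ⊗₁ V) ⨾ unitˡ⇒ {I}

  R₁ : ∀ {X Y} → Hom X Y → Pred Y → Pred X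
  R₁ f U = f ⨾ U

  -- pullback squares in Map(B):   p ⨾ g = q ⨾ h
  --        p
  --    Q ----> B
  --  q |       | g
  --    v       v
  --    C ----> D
  --        h
  IsPullback : ∀ {Q B C D} → Hom Q B → Hom Q C → Hom B D → Hom C D → Set (o ⊔ ℓ)
  IsPullback {Q} {B} {C} {D} p q g h =
    (p ⨾ g ≡ q ⨾ h) ×
    (∀ {Z} (u : Hom Z B) (v : Hom Z C) → IsMap u → IsMap v → u ⨾ g ≡ v ⨾ h →
       Σ (Hom Z Q) λ w → IsMap w × (w ⨾ p ≡ u) × (w ⨾ q ≡ v) ×
         (∀ (w' : Hom Z Q) → IsMap w' → w' ⨾ p ≡ u → w' ⨾ q ≡ v → w' ≡ w))

  record IsInfSLFunctor : Set (o ⊔ ℓ ⊔ r) where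
    field
      -- each R(X) is a meet-semilattice with top (poset laws are ≤-refl,
      -- ≤-trans, ≤-antisym of B)
      ⊤-top   : ∀ {X} (U : Pred X) → U ≤ ⊤
      ∧-lowerˡ : ∀ {X} (U V : Pred X) → U ∧ V ≤ U
      ∧-lowerʳ : ∀ {X} (U V : Pred X) → U ∧ V ≤ V
      ∧-greatest : ∀ {X} (U V W : Pred X) → W ≤ U → W ≤ V → W ≤ U ∧ V
      R₁-⊤ : ∀ {X Y} (f : Hom X Y) → IsMap f → R₁ f (⊤ {Y}) ≡ ⊤ {X}
      R₁-∧ : ∀ {X Y} (f : Hom X Y) → IsMap f → (U V : Pred Y) →
             R₁ f (U ∧ V) ≡ R₁ f U ∧ R₁ f V
      R₁-id : ∀ {X} (U : Pred X) → R₁ id U ≡ U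
      R₁-⨾  : ∀ {X Y Z} (f : Hom X Y) (g : Hom Y Z) → IsMap f → IsMap g →
              (U : Pred Z) → R₁ (f ⨾ g) U ≡ R₁ f (R₁ g U)

  -- Elementary: the right-hand side of the adjunction is  α ≤ P_e β
  -- with e = id_X × Δ_A : X × A → X × (A × A), and the candidate left
  -- adjoint  ∃_e α = P_⟨π₁,π₂⟩ α ∧ P_⟨π₂,π₃⟩ δ_A,  where on X × (A × A)
  -- π₁ = π₁, π₂ = π₂ ⨾ π₁, π₃ = π₂ ⨾ π₂.
  IsElementary : Set (o ⊔ ℓ ⊔ r)
  IsElementary =
    Σ (∀ (A : Obj) → Pred (A ⊗₀ A)) λ δ →
      ∀ {X A : Obj} (α : Pred (X ⊗₀ A)) (β : Pred (X ⊗₀ (A ⊗₀ A))) →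
        ((R₁ ⟨ π₁ {X} {A ⊗₀ A} , π₂ {X} {A ⊗₀ A} ⨾ π₁ {A} {A} ⟩ α
           ∧ R₁ ⟨ π₂ {X} {A ⊗₀ A} ⨾ π₁ {A} {A} , π₂ {X} {A ⊗₀ A} ⨾ π₂ {A} {A} ⟩ (δ A)) ≤ β)
          ⇔ (α ≤ R₁ (id {X} ×₁ Δ {A}) β)

  record IsExistential : Set (o ⊔ ℓ ⊔ r) where
    field
      ∃₁ : ∀ {A₁ A₂} → Pred (A₁ ⊗₀ A₂) → Pred A₁
      ∃₂ : ∀ {A₁ A₂} → Pred (A₁ ⊗₀ A₂) → Pred A₂
      ∃₁-adj : ∀ {A₁ A₂} (β : Pred (A₁ ⊗₀ A₂)) (α : Pred A₁) →
               (∃₁ β ≤ α) ⇔ (β ≤ R₁ π₁ α)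
      ∃₂-adj : ∀ {A₁ A₂} (β : Pred (A₁ ⊗₀ A₂)) (α : Pred A₂) →
               (∃₂ β ≤ α) ⇔ (β ≤ R₁ π₂ α)
      BC₂ : ∀ {X A X' A'} (f : Hom A' A) (f' : Hom (X' ⊗₀ A') (X ⊗₀ A)) →
            IsMap f → IsMap f' → IsPullback f' π₂ π₂ f →
            (β : Pred (X ⊗₀ A)) → ∃₂ (R₁ f' β) ≡ R₁ f (∃₂ β)
      BC₁ : ∀ {X A X' A'} (f : Hom A' A) (f' : Hom (A' ⊗₀ X') (A ⊗₀ X)) →
            IsMap f → IsMap f' → IsPullback f' π₁ π₁ f →
            (β : Pred (A ⊗₀ X)) → ∃₁ (R₁ f' β) ≡ R₁ f (∃₁ β)
      FR₂ : ∀ {X A} (α : Pred A) (β : Pred (X ⊗₀ A)) →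
            ∃₂ (R₁ π₂ α ∧ β) ≡ α ∧ ∃₂ β
      FR₁ : ∀ {X A} (α : Pred A) (β : Pred (A ⊗₀ X)) →
            ∃₁ (R₁ π₁ α ∧ β) ≡ α ∧ ∃₁ β

  record IsElementaryExistentialDoctrine : Set (o ⊔ ℓ ⊔ r) where
    field
      isInfSLFunctor : IsInfSLFunctor
      elementary     : IsElementary
      existential    : IsExistential

-- Maps are comonoid homomorphisms, so precomposing
-- with a map preserves the meets U ∧ V = d ⨾ (U ⊗ V) ⨾ l⇒, while laxness of an arbitrary W gives
-- W ≤ W ∧ W. A projection π = (id ⊗ e) ⨾ r⇒ inherits from e ⊣ e* a right adjoint π° in B, so
-- ∃_π = π° ⨾ - is left adjoint to π ⨾ -. Beck–Chevalley compares the mate of the pullback square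
-- with the canonical square, through the mediating map; Frobenius reciprocity comes from
-- π° ⨾ ⟨ π , id ⟩ = ⟨ id , π° ⟩. For equality take δ_A = d* ⨾ e: by the Frobenius law the
-- prescribed ∃_e α collapses to (id ⊗ d*) ⨾ α, and id ⊗ d ⊣ id ⊗ d* gives the adjunction.

module Submission where

open import Level using (Level; _⊔_)
open import Data.Product using (_×_; _,_; proj₂)
open import Function.Bundles using (_⇔_; mk⇔)
open import Relation.Binary.Bundles using (Poset)
open import Relation.Binary.PropositionalEquality
  using (_≡_; refl; sym; trans; cong; cong₂; subst; subst₂; isEquivalence; module ≡-Reasoning)
import Relation.Binary.Reasoning.PartialOrder as PartialOrderReasoning
open import Defs using (CartesianBicategory; IsElementaryExistentialDoctrine)
import Defs

module Properties {o ℓ r : Level} (𝔹 : CartesianBicategory o ℓ r) where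
  open CartesianBicategory 𝔹

  private variable
    A B C D A' B' X X' Y Z W : Obj

  a⇒ : Hom ((X ⊗₀ Y) ⊗₀ Z) (X ⊗₀ (Y ⊗₀ Z))
  a⇒ = assoc⇒
  a⇐ : Hom (X ⊗₀ (Y ⊗₀ Z)) ((X ⊗₀ Y) ⊗₀ Z)
  a⇐ = assoc⇐
  l⇒ : Hom (I ⊗₀ X) X
  l⇒ = unitˡ⇒
  l⇐ : Hom X (I ⊗₀ X)
  l⇐ = unitˡ⇐
  r⇒ : Hom (X ⊗₀ I) X
  r⇒ = unitʳ⇒
  r⇐ : Hom X (X ⊗₀ I)
  r⇐ = unitʳ⇐

  homPoset : Obj → Obj → Poset ℓ ℓ r
  homPoset X Y = record
    { Carrier = Hom X Y
    ; _≈_ = _≡_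
    ; _≤_ = _≤_
    ; isPartialOrder = record
      { isPreorder = record
        { isEquivalence = isEquivalence
        ; reflexive = λ { refl → ≤-refl }
        ; trans = ≤-trans
        }
      ; antisym = ≤-antisym
      }
    }

  module ≤-Reasoning {X Y : Obj} = PartialOrderReasoning (homPoset X Y)

  ≤-reflexive : {f g : Hom X Y} → f ≡ g → f ≤ g
  ≤-reflexive refl = ≤-refl

  ⨾-monoˡ : {f f' : Hom X Y} (g : Hom Y Z) → f ≤ f' → f ⨾ g ≤ f' ⨾ g
  ⨾-monoˡ g p = ⨾-mono p ≤-refl

  ⨾-monoʳ : (f : Hom X Y) {g g' : Hom Y Z} → g ≤ g' → f ⨾ g ≤ f ⨾ g'
  ⨾-monoʳ f p = ⨾-mono ≤-refl p

  infixr 5 _⟩⨾_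
  _⟩⨾_ : (f : Hom A B) {g h : Hom B C} → g ≡ h → f ⨾ g ≡ f ⨾ h
  f ⟩⨾ p = cong (f ⨾_) p

  pullˡ : {f : Hom A B} {g : Hom B C} {h : Hom A C} {k : Hom C D} →
          f ⨾ g ≡ h → f ⨾ (g ⨾ k) ≡ h ⨾ k
  pullˡ {f = f} {g} {h} {k} p = trans (sym (⨾-assoc f g k)) (cong (_⨾ k) p)

  pushˡ : {f : Hom A B} {g : Hom B C} {h : Hom A C} {k : Hom C D} →
          h ≡ f ⨾ g → h ⨾ k ≡ f ⨾ (g ⨾ k)
  pushˡ p = sym (pullˡ (sym p))

  replaceˡ : {x : Hom A B} {y : Hom B C} {y' : Hom A D} {x' : Hom D C} {k : Hom C W} →
           x ⨾ y ≡ y' ⨾ x' → x ⨾ y ⨾ k ≡ y' ⨾ x' ⨾ k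
  replaceˡ {y' = y'} {x'} {k} p = trans (pullˡ p) (⨾-assoc y' x' k)

  cancelˡ : {f : Hom A B} {g : Hom B A} {k : Hom A C} → f ⨾ g ≡ id → f ⨾ (g ⨾ k) ≡ k
  cancelˡ {k = k} p = trans (pullˡ p) (⨾-identityˡ k)

  cancelʳ : {f : Hom A B} {g : Hom B C} {h : Hom C B} → g ⨾ h ≡ id → f ⨾ (g ⨾ h) ≡ f
  cancelʳ {f = f} p = trans (cong (f ⨾_) p) (⨾-identityʳ f)

  switchˡ : {g : Hom A B} {g' : Hom B A} {f : Hom B C} {h : Hom A C} →
            g' ⨾ g ≡ id → g ⨾ f ≡ h → f ≡ g' ⨾ h
  switchˡ {g' = g'} inv p = trans (sym (cancelˡ inv)) (g' ⟩⨾ p)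

  switchʳ : {g : Hom B C} {g' : Hom C B} {f : Hom A B} {h : Hom A C} →
            g ⨾ g' ≡ id → f ⨾ g ≡ h → f ≡ h ⨾ g'
  switchʳ {g = g} {g'} {f} inv p =
    trans (sym (cancelʳ inv)) (trans (sym (⨾-assoc f g g')) (cong (_⨾ g') p))

  natural-inverse : {F : Hom A A'} {G : Hom B B'} {i : Hom A B} {j : Hom B A}
                    {i' : Hom A' B'} {j' : Hom B' A'} →
                    j ⨾ i ≡ id → i' ⨾ j' ≡ id → F ⨾ i' ≡ i ⨾ G → G ⨾ j' ≡ j ⨾ F
  natural-inverse {F = F} {G} {i} {j} {i'} {j'} ji ij' p = begin
    G ⨾ j'             ≡⟨ sym (cancelˡ ji) ⟩
    j ⨾ i ⨾ G ⨾ j'     ≡⟨ j ⟩⨾ pullˡ (sym p) ⟩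
    j ⨾ (F ⨾ i') ⨾ j'  ≡⟨ j ⟩⨾ trans (⨾-assoc F i' j') (cancelʳ ij') ⟩
    j ⨾ F              ∎
    where open ≡-Reasoning

  ⊗-splitˡ : (f : Hom A B) (g : Hom C D) → f ⊗₁ g ≡ (f ⊗₁ id) ⨾ (id ⊗₁ g)
  ⊗-splitˡ f g =
    trans (cong₂ _⊗₁_ (sym (⨾-identityʳ f)) (sym (⨾-identityˡ g))) (⊗-homo f id id g)

  ⊗-splitʳ : (f : Hom A B) (g : Hom C D) → f ⊗₁ g ≡ (id ⊗₁ g) ⨾ (f ⊗₁ id)
  ⊗-splitʳ f g =
    trans (cong₂ _⊗₁_ (sym (⨾-identityˡ f)) (sym (⨾-identityʳ g))) (⊗-homo id f g id)

  ⊗-interchange : (f : Hom A B) (g : Hom C D) → (id ⊗₁ g) ⨾ (f ⊗₁ id) ≡ (f ⊗₁ id) ⨾ (id ⊗₁ g)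
  ⊗-interchange f g = trans (sym (⊗-splitʳ f g)) (⊗-splitˡ f g)

  id⊗-homo : (f : Hom A B) (g : Hom B C) → id {X} ⊗₁ (f ⨾ g) ≡ (id ⊗₁ f) ⨾ (id ⊗₁ g)
  id⊗-homo f g = trans (cong (_⊗₁ (f ⨾ g)) (sym (⨾-identityˡ id))) (⊗-homo id id f g)

  ⊗id-homo : (f : Hom A B) (g : Hom B C) → (f ⨾ g) ⊗₁ id {X} ≡ (f ⊗₁ id) ⨾ (g ⊗₁ id)
  ⊗id-homo f g = trans (cong ((f ⨾ g) ⊗₁_) (sym (⨾-identityˡ id))) (⊗-homo f g id id)

  id⊗-slide : {f : Hom A B} {x : Hom C D} {y : Hom D X} {y' : Hom C Y} {x' : Hom Y X} →
              x ⨾ y ≡ y' ⨾ x' → (f ⊗₁ x) ⨾ (id ⊗₁ y) ≡ (id ⊗₁ y') ⨾ (f ⊗₁ x')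
  id⊗-slide {f = f} {x} {y} {y'} {x'} p = begin
    (f ⊗₁ x) ⨾ (id ⊗₁ y)   ≡⟨ sym (⊗-homo f id x y) ⟩
    (f ⨾ id) ⊗₁ (x ⨾ y)    ≡⟨ cong₂ _⊗₁_ (trans (⨾-identityʳ f) (sym (⨾-identityˡ f))) p ⟩
    (id ⨾ f) ⊗₁ (y' ⨾ x')  ≡⟨ ⊗-homo id f y' x' ⟩
    (id ⊗₁ y') ⨾ (f ⊗₁ x') ∎
    where open ≡-Reasoning

  ⊗id-slide : {f : Hom A B} {x : Hom C D} {y : Hom D X} {y' : Hom C Y} {x' : Hom Y X} →
              x ⨾ y ≡ y' ⨾ x' → (x ⊗₁ f) ⨾ (y ⊗₁ id) ≡ (y' ⊗₁ id) ⨾ (x' ⊗₁ f)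
  ⊗id-slide {f = f} {x} {y} {y'} {x'} p = begin
    (x ⊗₁ f) ⨾ (y ⊗₁ id)   ≡⟨ sym (⊗-homo x y f id) ⟩
    (x ⨾ y) ⊗₁ (f ⨾ id)    ≡⟨ cong₂ _⊗₁_ p (trans (⨾-identityʳ f) (sym (⨾-identityˡ f))) ⟩
    (y' ⨾ x') ⊗₁ (id ⨾ f)  ≡⟨ ⊗-homo y' x' id f ⟩
    (y' ⊗₁ id) ⨾ (x' ⊗₁ f) ∎
    where open ≡-Reasoning

  ⊗-inverse : {f : Hom A B} {g : Hom B A} {h : Hom C D} {k : Hom D C} →
              f ⨾ g ≡ id → h ⨾ k ≡ id → (f ⊗₁ h) ⨾ (g ⊗₁ k) ≡ id
  ⊗-inverse {f = f} {g} {h} {k} p q =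
    trans (sym (⊗-homo f g h k)) (trans (cong₂ _⊗₁_ p q) ⊗-identity)

  id⊗-inverse : {f : Hom A B} {g : Hom B A} → f ⨾ g ≡ id → (id {X} ⊗₁ f) ⨾ (id ⊗₁ g) ≡ id
  id⊗-inverse = ⊗-inverse (⨾-identityˡ id)

  ⊗id-inverse : {f : Hom A B} {g : Hom B A} → f ⨾ g ≡ id → (f ⊗₁ id {X}) ⨾ (g ⊗₁ id) ≡ id
  ⊗id-inverse p = ⊗-inverse p (⨾-identityˡ id)

  assoc⇐-natural : (f : Hom A B) (g : Hom C D) (h : Hom X Y) →
                   (f ⊗₁ (g ⊗₁ h)) ⨾ a⇐ ≡ a⇐ ⨾ ((f ⊗₁ g) ⊗₁ h)
  assoc⇐-natural f g h = natural-inverse assoc-isoʳ assoc-isoˡ (assoc-natural f g h)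

  unitˡ⇐-natural : (f : Hom A B) → f ⨾ l⇐ ≡ l⇐ ⨾ (id ⊗₁ f)
  unitˡ⇐-natural f = natural-inverse unitˡ-isoʳ unitˡ-isoˡ (unitˡ-natural f)

  unitʳ⇐-natural : (f : Hom A B) → f ⨾ r⇐ ≡ r⇐ ⨾ (f ⊗₁ id)
  unitʳ⇐-natural f = natural-inverse unitʳ-isoʳ unitʳ-isoˡ (unitʳ-natural f)

  iso-cancelˡ : {i : Hom A B} {j : Hom B A} {x y : Hom B C} → j ⨾ i ≡ id → i ⨾ x ≡ i ⨾ y → x ≡ y
  iso-cancelˡ ji p = trans (switchˡ ji p) (cancelˡ ji)

  iso-cancelʳ : {i : Hom B C} {j : Hom C B} {x y : Hom A B} → i ⨾ j ≡ id → x ⨾ i ≡ y ⨾ i → x ≡ y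
  iso-cancelʳ {i = i} {j} {y = y} ij p = trans (switchʳ ij p) (trans (⨾-assoc y i j) (cancelʳ ij))

  id⊗-cancel : {f g : Hom X Y} → id {I} ⊗₁ f ≡ id ⊗₁ g → f ≡ g
  id⊗-cancel {f = f} {g} p =
    iso-cancelˡ unitˡ-isoʳ
      (trans (sym (unitˡ-natural f)) (trans (cong (_⨾ l⇒) p) (unitˡ-natural g)))

  ⊗id-cancel : {f g : Hom X Y} → f ⊗₁ id {I} ≡ g ⊗₁ id → f ≡ g
  ⊗id-cancel {f = f} {g} p =
    iso-cancelˡ unitʳ-isoʳ
      (trans (sym (unitʳ-natural f)) (trans (cong (_⨾ r⇒) p) (unitʳ-natural g)))

  -- Kelly's coherence lemmas

  assoc-unitˡ : a⇒ {I} {X} {Y} ⨾ l⇒ ≡ l⇒ ⊗₁ id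
  assoc-unitˡ {X} {Y} =
    id⊗-cancel (iso-cancelˡ assoc-isoʳ (iso-cancelˡ (⊗id-inverse assoc-isoʳ) pentagon-unitˡ))
    where
    open ≡-Reasoning
    pentagon-unitˡ : (a⇒ {I} {I} {X} ⊗₁ id {Y}) ⨾ a⇒ ⨾ (id ⊗₁ (a⇒ ⨾ l⇒)) ≡
                     (a⇒ ⊗₁ id) ⨾ a⇒ ⨾ (id ⊗₁ (l⇒ ⊗₁ id))
    pentagon-unitˡ = begin
      (a⇒ ⊗₁ id) ⨾ a⇒ ⨾ (id ⊗₁ (a⇒ ⨾ l⇒))         ≡⟨ (a⇒ ⊗₁ id) ⟩⨾ a⇒ ⟩⨾ id⊗-homo a⇒ l⇒ ⟩
      (a⇒ ⊗₁ id) ⨾ a⇒ ⨾ (id ⊗₁ a⇒) ⨾ (id ⊗₁ l⇒)   ≡⟨ (a⇒ ⊗₁ id) ⟩⨾ sym (⨾-assoc _ _ _) ⟩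
      (a⇒ ⊗₁ id) ⨾ (a⇒ ⨾ (id ⊗₁ a⇒)) ⨾ (id ⊗₁ l⇒) ≡⟨ pullˡ pentagon ⟩
      (a⇒ ⨾ a⇒) ⨾ (id ⊗₁ l⇒)                       ≡⟨ trans (⨾-assoc _ _ _) (a⇒ ⟩⨾ triangle) ⟩
      a⇒ ⨾ (r⇒ ⊗₁ id)                              ≡⟨ a⇒ ⟩⨾ cong (r⇒ ⊗₁_) (sym ⊗-identity) ⟩
      a⇒ ⨾ (r⇒ ⊗₁ (id ⊗₁ id))                      ≡⟨ sym (assoc-natural r⇒ id id) ⟩
      ((r⇒ ⊗₁ id) ⊗₁ id) ⨾ a⇒                      ≡⟨ cong (λ z → (z ⊗₁ id) ⨾ a⇒) (sym triangle) ⟩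
      ((a⇒ ⨾ (id ⊗₁ l⇒)) ⊗₁ id) ⨾ a⇒               ≡⟨ cong (_⨾ a⇒) (⊗id-homo a⇒ (id ⊗₁ l⇒)) ⟩
      ((a⇒ ⊗₁ id) ⨾ ((id ⊗₁ l⇒) ⊗₁ id)) ⨾ a⇒       ≡⟨ ⨾-assoc _ _ _ ⟩
      (a⇒ ⊗₁ id) ⨾ ((id ⊗₁ l⇒) ⊗₁ id) ⨾ a⇒         ≡⟨ (a⇒ ⊗₁ id) ⟩⨾ assoc-natural id l⇒ id ⟩
      (a⇒ ⊗₁ id) ⨾ a⇒ ⨾ (id ⊗₁ (l⇒ ⊗₁ id))         ∎

  assoc-unitʳ : a⇒ {X} {Y} {I} ⨾ (id ⊗₁ r⇒) ≡ r⇒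
  assoc-unitʳ {X} {Y} = ⊗id-cancel (iso-cancelʳ assoc-isoˡ pentagon-unitʳ)
    where
    open ≡-Reasoning
    pentagon-unitʳ : ((a⇒ {X} {Y} {I} ⨾ (id ⊗₁ r⇒)) ⊗₁ id {I}) ⨾ a⇒ ≡ (r⇒ ⊗₁ id) ⨾ a⇒
    pentagon-unitʳ = begin
      ((a⇒ ⨾ (id ⊗₁ r⇒)) ⊗₁ id) ⨾ a⇒
        ≡⟨ cong (_⨾ a⇒) (⊗id-homo a⇒ (id ⊗₁ r⇒)) ⟩
      ((a⇒ ⊗₁ id) ⨾ ((id ⊗₁ r⇒) ⊗₁ id)) ⨾ a⇒
        ≡⟨ ⨾-assoc _ _ _ ⟩
      (a⇒ ⊗₁ id) ⨾ ((id ⊗₁ r⇒) ⊗₁ id) ⨾ a⇒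
        ≡⟨ (a⇒ ⊗₁ id) ⟩⨾ assoc-natural id r⇒ id ⟩
      (a⇒ ⊗₁ id) ⨾ a⇒ ⨾ (id ⊗₁ (r⇒ ⊗₁ id))
        ≡⟨ (a⇒ ⊗₁ id) ⟩⨾ a⇒ ⟩⨾ cong (id ⊗₁_) (sym triangle) ⟩
      (a⇒ ⊗₁ id) ⨾ a⇒ ⨾ (id ⊗₁ (a⇒ ⨾ (id ⊗₁ l⇒)))
        ≡⟨ (a⇒ ⊗₁ id) ⟩⨾ a⇒ ⟩⨾ id⊗-homo a⇒ (id ⊗₁ l⇒) ⟩
      (a⇒ ⊗₁ id) ⨾ a⇒ ⨾ (id ⊗₁ a⇒) ⨾ (id ⊗₁ (id ⊗₁ l⇒))
        ≡⟨ (a⇒ ⊗₁ id) ⟩⨾ sym (⨾-assoc _ _ _) ⟩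
      (a⇒ ⊗₁ id) ⨾ (a⇒ ⨾ (id ⊗₁ a⇒)) ⨾ (id ⊗₁ (id ⊗₁ l⇒))
        ≡⟨ pullˡ pentagon ⟩
      (a⇒ ⨾ a⇒) ⨾ (id ⊗₁ (id ⊗₁ l⇒))
        ≡⟨ ⨾-assoc _ _ _ ⟩
      a⇒ ⨾ a⇒ ⨾ (id ⊗₁ (id ⊗₁ l⇒))
        ≡⟨ a⇒ ⟩⨾ sym (assoc-natural id id l⇒) ⟩
      a⇒ ⨾ ((id ⊗₁ id) ⊗₁ l⇒) ⨾ a⇒
        ≡⟨ a⇒ ⟩⨾ cong (λ z → (z ⊗₁ l⇒) ⨾ a⇒) ⊗-identity ⟩
      a⇒ ⨾ (id ⊗₁ l⇒) ⨾ a⇒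
        ≡⟨ pullˡ triangle ⟩
      (r⇒ ⊗₁ id) ⨾ a⇒ ∎

  assoc⇐-unitˡ : a⇐ {I} {X} {Y} ⨾ (l⇒ ⊗₁ id) ≡ l⇒
  assoc⇐-unitˡ = sym (switchˡ assoc-isoʳ assoc-unitˡ)

  assoc⇐-triangle : a⇐ {X} {I} {Y} ⨾ (r⇒ ⊗₁ id) ≡ id ⊗₁ l⇒
  assoc⇐-triangle = sym (switchˡ assoc-isoʳ triangle)

  unitˡ⇐⊗id-assoc : (l⇐ {X} ⊗₁ id {Y}) ⨾ a⇒ ≡ l⇐
  unitˡ⇐⊗id-assoc =
    trans ((l⇐ ⊗₁ id) ⟩⨾ switchʳ unitˡ-isoˡ assoc-unitˡ) (cancelˡ (⊗id-inverse unitˡ-isoʳ))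

  unitʳ⇐⊗id-assoc : (r⇐ {X} ⊗₁ id {Y}) ⨾ a⇒ ≡ id ⊗₁ l⇐
  unitʳ⇐⊗id-assoc =
    trans ((r⇐ ⊗₁ id) ⟩⨾ switchʳ (id⊗-inverse unitˡ-isoˡ) triangle)
          (cancelˡ (⊗id-inverse unitʳ-isoʳ))

  unitʳ⇐-assoc : r⇐ {X ⊗₀ Y} ⨾ a⇒ ≡ id ⊗₁ r⇐
  unitʳ⇐-assoc = trans (r⇐ ⟩⨾ switchʳ (id⊗-inverse unitʳ-isoˡ) assoc-unitʳ) (cancelˡ unitʳ-isoʳ)

  id⊗unitʳ⇐-assoc⇐ : (id {X} ⊗₁ r⇐ {Y}) ⨾ a⇐ ≡ r⇐
  id⊗unitʳ⇐-assoc⇐ = sym (switchʳ assoc-isoˡ unitʳ⇐-assoc)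

  unitˡ⇐-assoc⇐ : l⇐ {X ⊗₀ Y} ⨾ a⇐ ≡ l⇐ ⊗₁ id
  unitˡ⇐-assoc⇐ = sym (switchʳ assoc-isoˡ unitˡ⇐⊗id-assoc)

  ⟨_,_⟩ : Hom Z X → Hom Z Y → Hom Z (X ⊗₀ Y)
  ⟨_,_⟩ = Defs.⟨_,_⟩ 𝔹

  π₁ : Hom (X ⊗₀ Y) X
  π₁ = Defs.π₁ 𝔹

  π₂ : Hom (X ⊗₀ Y) Y
  π₂ = Defs.π₂ 𝔹

  pair-id-id : ⟨ id , id ⟩ ≡ d {X}
  pair-id-id = trans (d ⟩⨾ ⊗-identity) (⨾-identityʳ d)

  d-counitˡ⇐ : d {X} ⨾ (e ⊗₁ id) ≡ l⇐
  d-counitˡ⇐ = trans (switchʳ unitˡ-isoˡ (trans (⨾-assoc _ _ _) d-counitˡ)) (⨾-identityˡ l⇐)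

  d-counitʳ⇐ : d {X} ⨾ (id ⊗₁ e) ≡ r⇐
  d-counitʳ⇐ = trans (switchʳ unitʳ-isoˡ (trans (⨾-assoc _ _ _) d-counitʳ)) (⨾-identityˡ r⇐)

  unitʳ≡unitˡ : r⇒ {I} ≡ l⇒
  unitʳ≡unitˡ = begin
    r⇒            ≡⟨ sym (cancelʳ unitˡ-isoʳ) ⟩
    r⇒ ⨾ l⇐ ⨾ l⇒  ≡⟨ r⇒ ⟩⨾ cong (_⨾ l⇒) unitˡ⇐≡unitʳ⇐ ⟩
    r⇒ ⨾ r⇐ ⨾ l⇒  ≡⟨ cancelˡ unitʳ-isoˡ ⟩
    l⇒            ∎
    where
    open ≡-Reasoning
    unitˡ⇐≡unitʳ⇐ : l⇐ {I} ≡ r⇐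
    unitˡ⇐≡unitʳ⇐ = begin
      l⇐             ≡⟨ sym d-I ⟩
      d              ≡⟨ sym (trans (cong (λ z → d ⨾ (id ⊗₁ z)) e-I) pair-id-id) ⟩
      d ⨾ (id ⊗₁ e)  ≡⟨ d-counitʳ⇐ ⟩
      r⇐             ∎

  σ-I : σ {I} {I} ≡ id
  σ-I = iso-cancelˡ unitˡ-isoˡ (begin
    l⇐ ⨾ σ  ≡⟨ cong (_⨾ σ) (sym d-I) ⟩
    d ⨾ σ   ≡⟨ d-cocomm ⟩
    d       ≡⟨ trans d-I (sym (⨾-identityʳ l⇐)) ⟩
    l⇐ ⨾ id ∎)
    where open ≡-Reasoning

  σ-unitˡ : σ {X} {I} ⨾ l⇒ ≡ r⇒
  σ-unitˡ = trans (switchˡ unitʳ-isoˡ unitʳ⇐-σ-unitˡ) (⨾-identityʳ r⇒)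
    where
    open ≡-Reasoning
    unitʳ⇐-σ-unitˡ : r⇐ ⨾ σ {X} {I} ⨾ l⇒ ≡ id
    unitʳ⇐-σ-unitˡ = begin
      r⇐ ⨾ σ ⨾ l⇒                ≡⟨ pushˡ (sym d-counitʳ⇐) ⟩
      d ⨾ (id ⊗₁ e) ⨾ σ ⨾ l⇒     ≡⟨ d ⟩⨾ replaceˡ (σ-natural id e) ⟩
      d ⨾ σ ⨾ (e ⊗₁ id) ⨾ l⇒     ≡⟨ pullˡ d-cocomm ⟩
      d ⨾ (e ⊗₁ id) ⨾ l⇒         ≡⟨ d-counitˡ ⟩
      id                         ∎

  σ-unitʳ : σ {I} {X} ⨾ r⇒ ≡ l⇒
  σ-unitʳ = trans (σ ⟩⨾ sym σ-unitˡ) (cancelˡ σ-involutive)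

  unitˡ⇐-σ : l⇐ ⨾ σ {I} {X} ≡ r⇐
  unitˡ⇐-σ = trans (l⇐ ⟩⨾ switchʳ unitʳ-isoˡ σ-unitʳ) (cancelˡ unitˡ-isoʳ)

  id⊗-homo₃ : (f : Hom A B) (g : Hom B C) (h : Hom C D) →
              id {X} ⊗₁ (f ⨾ g ⨾ h) ≡ (id ⊗₁ f) ⨾ (id ⊗₁ g) ⨾ (id ⊗₁ h)
  id⊗-homo₃ f g h = trans (id⊗-homo f (g ⨾ h)) ((id ⊗₁ f) ⟩⨾ id⊗-homo g h)

  exchange : Hom (X ⊗₀ (Y ⊗₀ Z)) (Y ⊗₀ (X ⊗₀ Z))
  exchange = a⇐ ⨾ (σ ⊗₁ id) ⨾ a⇒

  shuffle : Hom ((W ⊗₀ X) ⊗₀ (Y ⊗₀ Z)) ((W ⊗₀ Y) ⊗₀ (X ⊗₀ Z))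
  shuffle = a⇒ ⨾ (id ⊗₁ exchange) ⨾ a⇐

  d-⊗-shuffle : d {X ⊗₀ Y} ≡ (d ⊗₁ d) ⨾ shuffle
  d-⊗-shuffle = trans d-⊗ ((d ⊗₁ d) ⟩⨾ a⇒ ⟩⨾ sym (begin
    (id ⊗₁ exchange) ⨾ a⇐
      ≡⟨ cong (_⨾ a⇐) (id⊗-homo₃ a⇐ (σ ⊗₁ id) a⇒) ⟩
    ((id ⊗₁ a⇐) ⨾ (id ⊗₁ (σ ⊗₁ id)) ⨾ (id ⊗₁ a⇒)) ⨾ a⇐
      ≡⟨ ⨾-assoc _ _ _ ⟩
    (id ⊗₁ a⇐) ⨾ ((id ⊗₁ (σ ⊗₁ id)) ⨾ (id ⊗₁ a⇒)) ⨾ a⇐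
      ≡⟨ (id ⊗₁ a⇐) ⟩⨾ ⨾-assoc _ _ _ ⟩
    (id ⊗₁ a⇐) ⨾ (id ⊗₁ (σ ⊗₁ id)) ⨾ (id ⊗₁ a⇒) ⨾ a⇐ ∎))
    where open ≡-Reasoning

  exchange-natural : (f : Hom A A') (g : Hom B B') (h : Hom C X) →
                     (f ⊗₁ (g ⊗₁ h)) ⨾ exchange ≡ exchange ⨾ (g ⊗₁ (f ⊗₁ h))
  exchange-natural f g h = begin
    (f ⊗₁ (g ⊗₁ h)) ⨾ a⇐ ⨾ (σ ⊗₁ id) ⨾ a⇒  ≡⟨ replaceˡ (assoc⇐-natural f g h) ⟩
    a⇐ ⨾ ((f ⊗₁ g) ⊗₁ h) ⨾ (σ ⊗₁ id) ⨾ a⇒  ≡⟨ a⇐ ⟩⨾ replaceˡ (⊗id-slide (σ-natural f g)) ⟩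
    a⇐ ⨾ (σ ⊗₁ id) ⨾ ((g ⊗₁ f) ⊗₁ h) ⨾ a⇒  ≡⟨ a⇐ ⟩⨾ (σ ⊗₁ id) ⟩⨾ assoc-natural g f h ⟩
    a⇐ ⨾ (σ ⊗₁ id) ⨾ a⇒ ⨾ (g ⊗₁ (f ⊗₁ h))  ≡⟨ a⇐ ⟩⨾ sym (⨾-assoc _ _ _) ⟩
    a⇐ ⨾ ((σ ⊗₁ id) ⨾ a⇒) ⨾ (g ⊗₁ (f ⊗₁ h)) ≡⟨ sym (⨾-assoc _ _ _) ⟩
    exchange ⨾ (g ⊗₁ (f ⊗₁ h))             ∎
    where open ≡-Reasoning

  shuffle-natural : (f : Hom A A') (g : Hom B B') (h : Hom C X) (k : Hom D Y) →
                    ((f ⊗₁ g) ⊗₁ (h ⊗₁ k)) ⨾ shuffle ≡ shuffle ⨾ ((f ⊗₁ h) ⊗₁ (g ⊗₁ k))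
  shuffle-natural f g h k = begin
    ((f ⊗₁ g) ⊗₁ (h ⊗₁ k)) ⨾ a⇒ ⨾ (id ⊗₁ exchange) ⨾ a⇐
      ≡⟨ replaceˡ (assoc-natural f g (h ⊗₁ k)) ⟩
    a⇒ ⨾ (f ⊗₁ (g ⊗₁ (h ⊗₁ k))) ⨾ (id ⊗₁ exchange) ⨾ a⇐
      ≡⟨ a⇒ ⟩⨾ replaceˡ (id⊗-slide (exchange-natural g h k)) ⟩
    a⇒ ⨾ (id ⊗₁ exchange) ⨾ (f ⊗₁ (h ⊗₁ (g ⊗₁ k))) ⨾ a⇐
      ≡⟨ a⇒ ⟩⨾ (id ⊗₁ exchange) ⟩⨾ assoc⇐-natural f h (g ⊗₁ k) ⟩
    a⇒ ⨾ (id ⊗₁ exchange) ⨾ a⇐ ⨾ ((f ⊗₁ h) ⊗₁ (g ⊗₁ k))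
      ≡⟨ a⇒ ⟩⨾ sym (⨾-assoc _ _ _) ⟩
    a⇒ ⨾ ((id ⊗₁ exchange) ⨾ a⇐) ⨾ ((f ⊗₁ h) ⊗₁ (g ⊗₁ k))
      ≡⟨ sym (⨾-assoc _ _ _) ⟩
    shuffle ⨾ ((f ⊗₁ h) ⊗₁ (g ⊗₁ k)) ∎
    where open ≡-Reasoning

  pair-⊗ : (f : Hom X A) (g : Hom Y B) (h : Hom X C) (k : Hom Y D) →
           ⟨ f ⊗₁ g , h ⊗₁ k ⟩ ≡ (⟨ f , h ⟩ ⊗₁ ⟨ g , k ⟩) ⨾ shuffle
  pair-⊗ f g h k = begin
    d ⨾ ((f ⊗₁ g) ⊗₁ (h ⊗₁ k))                ≡⟨ pushˡ d-⊗-shuffle ⟩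
    (d ⊗₁ d) ⨾ shuffle ⨾ ((f ⊗₁ g) ⊗₁ (h ⊗₁ k)) ≡⟨ (d ⊗₁ d) ⟩⨾ sym (shuffle-natural f h g k) ⟩
    (d ⊗₁ d) ⨾ ((f ⊗₁ h) ⊗₁ (g ⊗₁ k)) ⨾ shuffle ≡⟨ pullˡ (sym (⊗-homo d (f ⊗₁ h) d (g ⊗₁ k))) ⟩
    (⟨ f , h ⟩ ⊗₁ ⟨ g , k ⟩) ⨾ shuffle          ∎
    where open ≡-Reasoning

  shuffle-unfold : (k : Hom ((W ⊗₀ Y) ⊗₀ (X ⊗₀ Z)) A) →
                   shuffle {W} {X} {Y} {Z} ⨾ k ≡ a⇒ ⨾ (id ⊗₁ exchange) ⨾ a⇐ ⨾ k
  shuffle-unfold k = trans (⨾-assoc _ _ _) (a⇒ ⟩⨾ ⨾-assoc _ _ _)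

  exchange-unfold : (k : Hom (Y ⊗₀ (X ⊗₀ Z)) A) →
                    exchange {X} {Y} {Z} ⨾ k ≡ a⇐ ⨾ (σ ⊗₁ id) ⨾ a⇒ ⨾ k
  exchange-unfold k = trans (⨾-assoc _ _ _) (a⇐ ⟩⨾ ⨾-assoc _ _ _)

  exchange-I : exchange {I} {I} {Y} ≡ id
  exchange-I = begin
    a⇐ ⨾ (σ ⊗₁ id) ⨾ a⇒   ≡⟨ a⇐ ⟩⨾ cong (λ z → (z ⊗₁ id) ⨾ a⇒) σ-I ⟩
    a⇐ ⨾ (id ⊗₁ id) ⨾ a⇒  ≡⟨ a⇐ ⟩⨾ trans (cong (_⨾ a⇒) ⊗-identity) (⨾-identityˡ a⇒) ⟩
    a⇐ ⨾ a⇒               ≡⟨ assoc-isoʳ ⟩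
    id                    ∎
    where open ≡-Reasoning

  exchange⨾unitˡ : exchange {X} {I} {A} ⨾ l⇒ ≡ id ⊗₁ l⇒
  exchange⨾unitˡ = begin
    exchange ⨾ l⇒                ≡⟨ exchange-unfold l⇒ ⟩
    a⇐ ⨾ (σ ⊗₁ id) ⨾ a⇒ ⨾ l⇒     ≡⟨ a⇐ ⟩⨾ (σ ⊗₁ id) ⟩⨾ assoc-unitˡ ⟩
    a⇐ ⨾ (σ ⊗₁ id) ⨾ (l⇒ ⊗₁ id)  ≡⟨ a⇐ ⟩⨾ trans (sym (⊗id-homo σ l⇒)) (cong (_⊗₁ id) σ-unitˡ) ⟩
    a⇐ ⨾ (r⇒ ⊗₁ id)              ≡⟨ assoc⇐-triangle ⟩
    id ⊗₁ l⇒                     ∎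
    where open ≡-Reasoning

  exchange⨾id⊗unitˡ : exchange {I} {A} {B} ⨾ (id ⊗₁ l⇒) ≡ l⇒
  exchange⨾id⊗unitˡ = begin
    exchange ⨾ (id ⊗₁ l⇒)             ≡⟨ exchange-unfold (id ⊗₁ l⇒) ⟩
    a⇐ ⨾ (σ ⊗₁ id) ⨾ a⇒ ⨾ (id ⊗₁ l⇒)  ≡⟨ a⇐ ⟩⨾ (σ ⊗₁ id) ⟩⨾ triangle ⟩
    a⇐ ⨾ (σ ⊗₁ id) ⨾ (r⇒ ⊗₁ id)       ≡⟨ a⇐ ⟩⨾ trans (sym (⊗id-homo σ r⇒)) (cong (_⊗₁ id) σ-unitʳ) ⟩
    a⇐ ⨾ (l⇒ ⊗₁ id)                   ≡⟨ assoc⇐-unitˡ ⟩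
    l⇒                                ∎
    where open ≡-Reasoning

  shuffle-I₂₃ : shuffle {X} {I} {I} {Y} ≡ id
  shuffle-I₂₃ = trans (a⇒ ⟩⨾ trans (cong (λ z → (id ⊗₁ z) ⨾ a⇐) exchange-I)
                                   (trans (cong (_⨾ a⇐) ⊗-identity) (⨾-identityˡ a⇐)))
                      assoc-isoˡ

  shuffle-I₁ : (l⇐ {X} ⊗₁ id {A ⊗₀ B}) ⨾ shuffle ⨾ (l⇒ ⊗₁ id) ≡ exchange
  shuffle-I₁ = begin
    (l⇐ ⊗₁ id) ⨾ shuffle ⨾ (l⇒ ⊗₁ id)
      ≡⟨ (l⇐ ⊗₁ id) ⟩⨾ shuffle-unfold _ ⟩
    (l⇐ ⊗₁ id) ⨾ a⇒ ⨾ (id ⊗₁ exchange) ⨾ a⇐ ⨾ (l⇒ ⊗₁ id)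
      ≡⟨ (l⇐ ⊗₁ id) ⟩⨾ a⇒ ⟩⨾ (id ⊗₁ exchange) ⟩⨾ assoc⇐-unitˡ ⟩
    (l⇐ ⊗₁ id) ⨾ a⇒ ⨾ (id ⊗₁ exchange) ⨾ l⇒
      ≡⟨ (l⇐ ⊗₁ id) ⟩⨾ a⇒ ⟩⨾ unitˡ-natural exchange ⟩
    (l⇐ ⊗₁ id) ⨾ a⇒ ⨾ l⇒ ⨾ exchange
      ≡⟨ pullˡ unitˡ⇐⊗id-assoc ⟩
    l⇐ ⨾ l⇒ ⨾ exchange
      ≡⟨ cancelˡ unitˡ-isoʳ ⟩
    exchange ∎
    where open ≡-Reasoning

  shuffle-I₂ : (r⇐ {X} ⊗₁ id {A ⊗₀ B}) ⨾ shuffle ⨾ (id ⊗₁ l⇒) ≡ a⇐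
  shuffle-I₂ = begin
    (r⇐ ⊗₁ id) ⨾ shuffle ⨾ (id ⊗₁ l⇒)
      ≡⟨ (r⇐ ⊗₁ id) ⟩⨾ shuffle-unfold _ ⟩
    (r⇐ ⊗₁ id) ⨾ a⇒ ⨾ (id ⊗₁ exchange) ⨾ a⇐ ⨾ (id ⊗₁ l⇒)
      ≡⟨ (r⇐ ⊗₁ id) ⟩⨾ a⇒ ⟩⨾ (id ⊗₁ exchange) ⟩⨾ a⇐ ⟩⨾ cong (_⊗₁ l⇒) (sym ⊗-identity) ⟩
    (r⇐ ⊗₁ id) ⨾ a⇒ ⨾ (id ⊗₁ exchange) ⨾ a⇐ ⨾ ((id ⊗₁ id) ⊗₁ l⇒)
      ≡⟨ (r⇐ ⊗₁ id) ⟩⨾ a⇒ ⟩⨾ (id ⊗₁ exchange) ⟩⨾ sym (assoc⇐-natural id id l⇒) ⟩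
    (r⇐ ⊗₁ id) ⨾ a⇒ ⨾ (id ⊗₁ exchange) ⨾ (id ⊗₁ (id ⊗₁ l⇒)) ⨾ a⇐
      ≡⟨ (r⇐ ⊗₁ id) ⟩⨾ a⇒ ⟩⨾ pullˡ (sym (id⊗-homo exchange (id ⊗₁ l⇒))) ⟩
    (r⇐ ⊗₁ id) ⨾ a⇒ ⨾ (id ⊗₁ (exchange ⨾ (id ⊗₁ l⇒))) ⨾ a⇐
      ≡⟨ (r⇐ ⊗₁ id) ⟩⨾ a⇒ ⟩⨾ cong (λ z → (id ⊗₁ z) ⨾ a⇐) exchange⨾id⊗unitˡ ⟩
    (r⇐ ⊗₁ id) ⨾ a⇒ ⨾ (id ⊗₁ l⇒) ⨾ a⇐
      ≡⟨ pullˡ unitʳ⇐⊗id-assoc ⟩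
    (id ⊗₁ l⇐) ⨾ (id ⊗₁ l⇒) ⨾ a⇐
      ≡⟨ cancelˡ (id⊗-inverse unitˡ-isoʳ) ⟩
    a⇐ ∎
    where open ≡-Reasoning

  shuffle-I₃ : (id {W ⊗₀ X} ⊗₁ l⇐ {A}) ⨾ shuffle ⨾ (r⇒ ⊗₁ id) ≡ a⇒
  shuffle-I₃ = begin
    (id ⊗₁ l⇐) ⨾ shuffle ⨾ (r⇒ ⊗₁ id)
      ≡⟨ (id ⊗₁ l⇐) ⟩⨾ shuffle-unfold _ ⟩
    (id ⊗₁ l⇐) ⨾ a⇒ ⨾ (id ⊗₁ exchange) ⨾ a⇐ ⨾ (r⇒ ⊗₁ id)
      ≡⟨ (id ⊗₁ l⇐) ⟩⨾ a⇒ ⟩⨾ (id ⊗₁ exchange) ⟩⨾ assoc⇐-triangle ⟩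
    (id ⊗₁ l⇐) ⨾ a⇒ ⨾ (id ⊗₁ exchange) ⨾ (id ⊗₁ l⇒)
      ≡⟨ (id ⊗₁ l⇐) ⟩⨾ a⇒ ⟩⨾ sym (id⊗-homo exchange l⇒) ⟩
    (id ⊗₁ l⇐) ⨾ a⇒ ⨾ (id ⊗₁ (exchange ⨾ l⇒))
      ≡⟨ (id ⊗₁ l⇐) ⟩⨾ a⇒ ⟩⨾ cong (id ⊗₁_) exchange⨾unitˡ ⟩
    (id ⊗₁ l⇐) ⨾ a⇒ ⨾ (id ⊗₁ (id ⊗₁ l⇒))
      ≡⟨ cong (λ z → (z ⊗₁ l⇐) ⨾ a⇒ ⨾ (id ⊗₁ (id ⊗₁ l⇒))) (sym ⊗-identity) ⟩
    ((id ⊗₁ id) ⊗₁ l⇐) ⨾ a⇒ ⨾ (id ⊗₁ (id ⊗₁ l⇒))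
      ≡⟨ replaceˡ (assoc-natural id id l⇐) ⟩
    a⇒ ⨾ (id ⊗₁ (id ⊗₁ l⇐)) ⨾ (id ⊗₁ (id ⊗₁ l⇒))
      ≡⟨ cancelʳ (id⊗-inverse (id⊗-inverse unitˡ-isoʳ)) ⟩
    a⇒ ∎
    where open ≡-Reasoning

  ⊗id⊗id-homo : (f : Hom A B) (g : Hom B C) →
                (f ⨾ g) ⊗₁ id {X ⊗₀ Y} ≡ (f ⊗₁ (id ⊗₁ id)) ⨾ (g ⊗₁ id)
  ⊗id⊗id-homo f g =
    trans (cong ((f ⨾ g) ⊗₁_) (sym (trans (⨾-identityʳ _) ⊗-identity))) (⊗-homo f g (id ⊗₁ id) id)

  pair-π₁-π₂ : ⟨ π₁ {X} {Y} , π₂ ⟩ ≡ id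
  pair-π₁-π₂ = begin
    d ⨾ (π₁ ⊗₁ π₂)
      ≡⟨ d ⟩⨾ ⊗-homo (id ⊗₁ e) r⇒ (e ⊗₁ id) l⇒ ⟩
    d ⨾ ((id ⊗₁ e) ⊗₁ (e ⊗₁ id)) ⨾ (r⇒ ⊗₁ l⇒)
      ≡⟨ replaceˡ (pair-⊗ id e e id) ⟩
    (⟨ id , e ⟩ ⊗₁ ⟨ e , id ⟩) ⨾ shuffle ⨾ (r⇒ ⊗₁ l⇒)
      ≡⟨ cong (_⨾ shuffle ⨾ (r⇒ ⊗₁ l⇒)) (cong₂ _⊗₁_ d-counitʳ⇐ d-counitˡ⇐) ⟩
    (r⇐ ⊗₁ l⇐) ⨾ shuffle ⨾ (r⇒ ⊗₁ l⇒)
      ≡⟨ (r⇐ ⊗₁ l⇐) ⟩⨾ trans (cong (_⨾ (r⇒ ⊗₁ l⇒)) shuffle-I₂₃) (⨾-identityˡ _) ⟩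
    (r⇐ ⊗₁ l⇐) ⨾ (r⇒ ⊗₁ l⇒)
      ≡⟨ ⊗-inverse unitʳ-isoʳ unitˡ-isoʳ ⟩
    id ∎
    where open ≡-Reasoning

  pair-π₁-id : ⟨ π₁ {X} {A} , id ⟩ ≡ (d ⊗₁ id) ⨾ a⇒
  pair-π₁-id = begin
    d ⨾ (π₁ ⊗₁ id)
      ≡⟨ d ⟩⨾ ⊗id⊗id-homo (id ⊗₁ e) r⇒ ⟩
    d ⨾ ((id ⊗₁ e) ⊗₁ (id ⊗₁ id)) ⨾ (r⇒ ⊗₁ id)
      ≡⟨ replaceˡ (pair-⊗ id e id id) ⟩
    (⟨ id , id ⟩ ⊗₁ ⟨ e , id ⟩) ⨾ shuffle ⨾ (r⇒ ⊗₁ id)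
      ≡⟨ cong (_⨾ shuffle ⨾ (r⇒ ⊗₁ id)) (cong₂ _⊗₁_ pair-id-id d-counitˡ⇐) ⟩
    (d ⊗₁ l⇐) ⨾ shuffle ⨾ (r⇒ ⊗₁ id)
      ≡⟨ pushˡ (⊗-splitˡ d l⇐) ⟩
    (d ⊗₁ id) ⨾ (id ⊗₁ l⇐) ⨾ shuffle ⨾ (r⇒ ⊗₁ id)
      ≡⟨ (d ⊗₁ id) ⟩⨾ shuffle-I₃ ⟩
    (d ⊗₁ id) ⨾ a⇒ ∎
    where open ≡-Reasoning

  pair-π₂-id : ⟨ π₂ {X} {A} , id ⟩ ≡ (id ⊗₁ d) ⨾ exchange
  pair-π₂-id = begin
    d ⨾ (π₂ ⊗₁ id)
      ≡⟨ d ⟩⨾ ⊗id⊗id-homo (e ⊗₁ id) l⇒ ⟩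
    d ⨾ ((e ⊗₁ id) ⊗₁ (id ⊗₁ id)) ⨾ (l⇒ ⊗₁ id)
      ≡⟨ replaceˡ (pair-⊗ e id id id) ⟩
    (⟨ e , id ⟩ ⊗₁ ⟨ id , id ⟩) ⨾ shuffle ⨾ (l⇒ ⊗₁ id)
      ≡⟨ cong (_⨾ shuffle ⨾ (l⇒ ⊗₁ id)) (cong₂ _⊗₁_ d-counitˡ⇐ pair-id-id) ⟩
    (l⇐ ⊗₁ d) ⨾ shuffle ⨾ (l⇒ ⊗₁ id)
      ≡⟨ pushˡ (⊗-splitʳ l⇐ d) ⟩
    (id ⊗₁ d) ⨾ (l⇐ ⊗₁ id) ⨾ shuffle ⨾ (l⇒ ⊗₁ id)
      ≡⟨ (id ⊗₁ d) ⟩⨾ shuffle-I₁ ⟩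
    (id ⊗₁ d) ⨾ exchange ∎
    where open ≡-Reasoning

  pair-id⊗-π₂ : (g : Hom B A) → ⟨ id {X} ⊗₁ g , π₂ ⟩ ≡ (id ⊗₁ ⟨ g , id ⟩) ⨾ a⇐
  pair-id⊗-π₂ g = begin
    d ⨾ ((id ⊗₁ g) ⊗₁ π₂)
      ≡⟨ d ⟩⨾ cong (_⊗₁ π₂) (sym (⨾-identityʳ _)) ⟩
    d ⨾ (((id ⊗₁ g) ⨾ id) ⊗₁ ((e ⊗₁ id) ⨾ l⇒))
      ≡⟨ d ⟩⨾ ⊗-homo (id ⊗₁ g) id (e ⊗₁ id) l⇒ ⟩
    d ⨾ ((id ⊗₁ g) ⊗₁ (e ⊗₁ id)) ⨾ (id ⊗₁ l⇒)
      ≡⟨ replaceˡ (pair-⊗ id g e id) ⟩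
    (⟨ id , e ⟩ ⊗₁ ⟨ g , id ⟩) ⨾ shuffle ⨾ (id ⊗₁ l⇒)
      ≡⟨ cong (λ z → (z ⊗₁ ⟨ g , id ⟩) ⨾ shuffle ⨾ (id ⊗₁ l⇒)) d-counitʳ⇐ ⟩
    (r⇐ ⊗₁ ⟨ g , id ⟩) ⨾ shuffle ⨾ (id ⊗₁ l⇒)
      ≡⟨ pushˡ (⊗-splitʳ r⇐ ⟨ g , id ⟩) ⟩
    (id ⊗₁ ⟨ g , id ⟩) ⨾ (r⇐ ⊗₁ id) ⨾ shuffle ⨾ (id ⊗₁ l⇒)
      ≡⟨ (id ⊗₁ ⟨ g , id ⟩) ⟩⨾ shuffle-I₂ ⟩
    (id ⊗₁ ⟨ g , id ⟩) ⨾ a⇐ ∎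
    where open ≡-Reasoning

  d-coassoc⇐ : d {X} ⨾ (id ⊗₁ d) ⨾ a⇐ ≡ d ⨾ (d ⊗₁ id)
  d-coassoc⇐ = sym (trans (switchʳ assoc-isoˡ (trans (⨾-assoc _ _ _) d-coassoc)) (⨾-assoc _ _ _))

  d-coassoc₄ : d {X} ⨾ (d ⊗₁ d) ⨾ a⇒ ≡ d ⨾ (id ⊗₁ (d ⨾ (id ⊗₁ d)))
  d-coassoc₄ = begin
    d ⨾ (d ⊗₁ d) ⨾ a⇒
      ≡⟨ d ⟩⨾ pushˡ (⊗-splitˡ d d) ⟩
    d ⨾ (d ⊗₁ id) ⨾ (id ⊗₁ d) ⨾ a⇒
      ≡⟨ d ⟩⨾ (d ⊗₁ id) ⟩⨾ cong (λ z → (z ⊗₁ d) ⨾ a⇒) (sym ⊗-identity) ⟩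
    d ⨾ (d ⊗₁ id) ⨾ ((id ⊗₁ id) ⊗₁ d) ⨾ a⇒
      ≡⟨ d ⟩⨾ (d ⊗₁ id) ⟩⨾ assoc-natural id id d ⟩
    d ⨾ (d ⊗₁ id) ⨾ a⇒ ⨾ (id ⊗₁ (id ⊗₁ d))
      ≡⟨ d ⟩⨾ sym (⨾-assoc _ _ _) ⟩
    d ⨾ ((d ⊗₁ id) ⨾ a⇒) ⨾ (id ⊗₁ (id ⊗₁ d))
      ≡⟨ pullˡ d-coassoc ⟩
    (d ⨾ (id ⊗₁ d)) ⨾ (id ⊗₁ (id ⊗₁ d))
      ≡⟨ trans (⨾-assoc _ _ _) (d ⟩⨾ sym (id⊗-homo d (id ⊗₁ d))) ⟩
    d ⨾ (id ⊗₁ (d ⨾ (id ⊗₁ d))) ∎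
    where open ≡-Reasoning

  d-exchange : d {X} ⨾ (id ⊗₁ d) ⨾ exchange ≡ d ⨾ (id ⊗₁ d)
  d-exchange = begin
    d ⨾ (id ⊗₁ d) ⨾ exchange
      ≡⟨ d ⟩⨾ sym (⨾-assoc _ _ _) ⟩
    d ⨾ ((id ⊗₁ d) ⨾ a⇐) ⨾ (σ ⊗₁ id) ⨾ a⇒
      ≡⟨ pullˡ d-coassoc⇐ ⟩
    (d ⨾ (d ⊗₁ id)) ⨾ (σ ⊗₁ id) ⨾ a⇒
      ≡⟨ ⨾-assoc _ _ _ ⟩
    d ⨾ (d ⊗₁ id) ⨾ (σ ⊗₁ id) ⨾ a⇒
      ≡⟨ d ⟩⨾ pullˡ (trans (sym (⊗id-homo d σ)) (cong (_⊗₁ id) d-cocomm)) ⟩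
    d ⨾ (d ⊗₁ id) ⨾ a⇒
      ≡⟨ d-coassoc ⟩
    d ⨾ (id ⊗₁ d) ∎
    where open ≡-Reasoning

  IsMap : Hom X Y → Set ℓ
  IsMap = Defs.IsMap 𝔹

  map-id : IsMap (id {X})
  map-id = trans (⨾-identityˡ d) (sym pair-id-id) , ⨾-identityˡ e

  map-⨾ : {f : Hom X Y} {g : Hom Y Z} → IsMap f → IsMap g → IsMap (f ⨾ g)
  map-⨾ {f = f} {g} (f-d , f-e) (g-d , g-e) =
    (begin
      (f ⨾ g) ⨾ d            ≡⟨ trans (⨾-assoc _ _ _) (f ⟩⨾ g-d) ⟩
      f ⨾ d ⨾ (g ⊗₁ g)       ≡⟨ pullˡ f-d ⟩
      (d ⨾ (f ⊗₁ f)) ⨾ (g ⊗₁ g) ≡⟨ trans (⨾-assoc _ _ _) (d ⟩⨾ sym (⊗-homo f g f g)) ⟩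
      d ⨾ ((f ⨾ g) ⊗₁ (f ⨾ g)) ∎) ,
    trans (⨾-assoc _ _ _) (trans (f ⟩⨾ g-e) f-e)
    where open ≡-Reasoning

  map-⊗ : {f : Hom A B} {g : Hom C D} → IsMap f → IsMap g → IsMap (f ⊗₁ g)
  map-⊗ {f = f} {g} (f-d , f-e) (g-d , g-e) =
    (begin
      (f ⊗₁ g) ⨾ d
        ≡⟨ (f ⊗₁ g) ⟩⨾ d-⊗-shuffle ⟩
      (f ⊗₁ g) ⨾ (d ⊗₁ d) ⨾ shuffle
        ≡⟨ pullˡ (trans (sym (⊗-homo f d g d)) (cong₂ _⊗₁_ f-d g-d)) ⟩
      ((d ⨾ (f ⊗₁ f)) ⊗₁ (d ⨾ (g ⊗₁ g))) ⨾ shuffle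
        ≡⟨ pushˡ (⊗-homo d (f ⊗₁ f) d (g ⊗₁ g)) ⟩
      (d ⊗₁ d) ⨾ ((f ⊗₁ f) ⊗₁ (g ⊗₁ g)) ⨾ shuffle
        ≡⟨ (d ⊗₁ d) ⟩⨾ shuffle-natural f f g g ⟩
      (d ⊗₁ d) ⨾ shuffle ⨾ ((f ⊗₁ g) ⊗₁ (f ⊗₁ g))
        ≡⟨ sym (pushˡ d-⊗-shuffle) ⟩
      d ⨾ ((f ⊗₁ g) ⊗₁ (f ⊗₁ g)) ∎) ,
    (begin
      (f ⊗₁ g) ⨾ e               ≡⟨ (f ⊗₁ g) ⟩⨾ e-⊗ ⟩
      (f ⊗₁ g) ⨾ (e ⊗₁ e) ⨾ l⇒   ≡⟨ pullˡ (trans (sym (⊗-homo f e g e)) (cong₂ _⊗₁_ f-e g-e)) ⟩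
      (e ⊗₁ e) ⨾ l⇒              ≡⟨ sym e-⊗ ⟩
      e                          ∎)
    where open ≡-Reasoning

  map-e : IsMap (e {X})
  map-e =
    (begin
      e ⨾ d                     ≡⟨ e ⟩⨾ d-I ⟩
      e ⨾ l⇐                    ≡⟨ unitˡ⇐-natural e ⟩
      l⇐ ⨾ (id ⊗₁ e)            ≡⟨ pushˡ (sym d-counitˡ⇐) ⟩
      d ⨾ (e ⊗₁ id) ⨾ (id ⊗₁ e) ≡⟨ d ⟩⨾ sym (⊗-splitˡ e e) ⟩
      d ⨾ (e ⊗₁ e)              ∎) ,
    trans (e ⟩⨾ e-I) (⨾-identityʳ e)
    where open ≡-Reasoning

  map-d : IsMap (d {X})
  map-d =
    (begin
      d ⨾ d
        ≡⟨ d ⟩⨾ d-⊗-shuffle ⟩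
      d ⨾ (d ⊗₁ d) ⨾ a⇒ ⨾ (id ⊗₁ exchange) ⨾ a⇐
        ≡⟨ sym (trans (⨾-assoc _ _ _) (d ⟩⨾ ⨾-assoc _ _ _)) ⟩
      (d ⨾ (d ⊗₁ d) ⨾ a⇒) ⨾ (id ⊗₁ exchange) ⨾ a⇐
        ≡⟨ cong (_⨾ (id ⊗₁ exchange) ⨾ a⇐) d-coassoc₄ ⟩
      (d ⨾ (id ⊗₁ (d ⨾ (id ⊗₁ d)))) ⨾ (id ⊗₁ exchange) ⨾ a⇐
        ≡⟨ ⨾-assoc _ _ _ ⟩
      d ⨾ (id ⊗₁ (d ⨾ (id ⊗₁ d))) ⨾ (id ⊗₁ exchange) ⨾ a⇐
        ≡⟨ d ⟩⨾ pullˡ (sym (id⊗-homo _ exchange)) ⟩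
      d ⨾ (id ⊗₁ ((d ⨾ (id ⊗₁ d)) ⨾ exchange)) ⨾ a⇐
        ≡⟨ d ⟩⨾ cong (λ z → (id ⊗₁ z) ⨾ a⇐) (trans (⨾-assoc _ _ _) d-exchange) ⟩
      d ⨾ (id ⊗₁ (d ⨾ (id ⊗₁ d))) ⨾ a⇐
        ≡⟨ pullˡ (sym d-coassoc₄) ⟩
      (d ⨾ (d ⊗₁ d) ⨾ a⇒) ⨾ a⇐
        ≡⟨ trans (⨾-assoc _ _ _) (d ⟩⨾ trans (⨾-assoc _ _ _) (cancelʳ assoc-isoˡ)) ⟩
      d ⨾ (d ⊗₁ d) ∎) ,
    (begin
      d ⨾ e                      ≡⟨ d ⟩⨾ e-⊗ ⟩
      d ⨾ (e ⊗₁ e) ⨾ l⇒          ≡⟨ d ⟩⨾ pushˡ (⊗-splitˡ e e) ⟩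
      d ⨾ (e ⊗₁ id) ⨾ (id ⊗₁ e) ⨾ l⇒ ≡⟨ d ⟩⨾ (e ⊗₁ id) ⟩⨾ unitˡ-natural e ⟩
      d ⨾ (e ⊗₁ id) ⨾ l⇒ ⨾ e     ≡⟨ d ⟩⨾ sym (⨾-assoc _ _ _) ⟩
      d ⨾ ((e ⊗₁ id) ⨾ l⇒) ⨾ e   ≡⟨ pullˡ d-counitˡ ⟩
      id ⨾ e                     ≡⟨ ⨾-identityˡ e ⟩
      e                          ∎)
    where open ≡-Reasoning

  map-inverse : {f : Hom X Y} {g : Hom Y X} → IsMap f → f ⨾ g ≡ id → g ⨾ f ≡ id → IsMap g
  map-inverse {f = f} {g} (f-d , f-e) fg gf =
    (begin
      g ⨾ d                         ≡⟨ g ⟩⨾ sym (trans (d ⟩⨾ ⊗-inverse fg fg) (⨾-identityʳ d)) ⟩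
      g ⨾ d ⨾ (f ⊗₁ f) ⨾ (g ⊗₁ g)   ≡⟨ g ⟩⨾ pullˡ (sym f-d) ⟩
      g ⨾ (f ⨾ d) ⨾ (g ⊗₁ g)        ≡⟨ g ⟩⨾ ⨾-assoc _ _ _ ⟩
      g ⨾ f ⨾ d ⨾ (g ⊗₁ g)          ≡⟨ cancelˡ gf ⟩
      d ⨾ (g ⊗₁ g)                  ∎) ,
    trans (g ⟩⨾ sym f-e) (cancelˡ gf)
    where open ≡-Reasoning

  map-unitʳ⇒ : IsMap (r⇒ {X})
  map-unitʳ⇒ = map-inverse (subst IsMap d-counitʳ⇐ (map-⨾ map-d (map-⊗ map-id map-e)))
                           unitʳ-isoʳ unitʳ-isoˡ

  map-unitˡ⇒ : IsMap (l⇒ {X})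
  map-unitˡ⇒ = map-inverse (subst IsMap d-counitˡ⇐ (map-⨾ map-d (map-⊗ map-e map-id)))
                           unitˡ-isoʳ unitˡ-isoˡ

  map-π₁ : IsMap (π₁ {X} {Y})
  map-π₁ = map-⨾ (map-⊗ map-id map-e) map-unitʳ⇒

  map-π₂ : IsMap (π₂ {X} {Y})
  map-π₂ = map-⨾ (map-⊗ map-e map-id) map-unitˡ⇒

  pair-⨾-⊗ : (f : Hom X A) (g : Hom X B) (h : Hom A C) (k : Hom B D) →
             ⟨ f , g ⟩ ⨾ (h ⊗₁ k) ≡ ⟨ f ⨾ h , g ⨾ k ⟩
  pair-⨾-⊗ f g h k = trans (⨾-assoc _ _ _) (d ⟩⨾ sym (⊗-homo f h g k))

  map-⨾-pair : {h : Hom X Y} → IsMap h → (f : Hom Y A) (g : Hom Y B) →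
               h ⨾ ⟨ f , g ⟩ ≡ ⟨ h ⨾ f , h ⨾ g ⟩
  map-⨾-pair {h = h} (h-d , _) f g = trans (pullˡ h-d) (pair-⨾-⊗ h h f g)

  -- The meet-semilattices Hom(X, I)

  Pred : Obj → Set ℓ
  Pred = Defs.Pred 𝔹

  _∧_ : Pred X → Pred X → Pred X
  _∧_ = Defs._∧_ 𝔹

  ∧-pair : (U V : Pred X) → U ∧ V ≡ ⟨ U , V ⟩ ⨾ l⇒
  ∧-pair U V = sym (⨾-assoc _ _ _)

  ⊤-top : (U : Pred X) → U ≤ e
  ⊤-top U = subst (_≤ e) (trans (U ⟩⨾ e-I) (⨾-identityʳ U)) (lax-e U)

  ⊤-∧ : (V : Pred X) → e ∧ V ≡ V
  ⊤-∧ V = begin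
    d ⨾ (e ⊗₁ V) ⨾ l⇒             ≡⟨ d ⟩⨾ pushˡ (⊗-splitˡ e V) ⟩
    d ⨾ (e ⊗₁ id) ⨾ (id ⊗₁ V) ⨾ l⇒ ≡⟨ d ⟩⨾ (e ⊗₁ id) ⟩⨾ unitˡ-natural V ⟩
    d ⨾ (e ⊗₁ id) ⨾ l⇒ ⨾ V         ≡⟨ d ⟩⨾ sym (⨾-assoc _ _ _) ⟩
    d ⨾ ((e ⊗₁ id) ⨾ l⇒) ⨾ V       ≡⟨ cancelˡ d-counitˡ ⟩
    V                              ∎
    where open ≡-Reasoning

  ∧-comm : (U V : Pred X) → U ∧ V ≡ V ∧ U
  ∧-comm U V = begin
    d ⨾ (U ⊗₁ V) ⨾ l⇒       ≡⟨ pushˡ (sym d-cocomm) ⟩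
    d ⨾ σ ⨾ (U ⊗₁ V) ⨾ l⇒   ≡⟨ d ⟩⨾ replaceˡ (sym (σ-natural V U)) ⟩
    d ⨾ (V ⊗₁ U) ⨾ σ ⨾ l⇒   ≡⟨ d ⟩⨾ (V ⊗₁ U) ⟩⨾ trans (cong (_⨾ l⇒) σ-I) (⨾-identityˡ l⇒) ⟩
    d ⨾ (V ⊗₁ U) ⨾ l⇒       ∎
    where open ≡-Reasoning

  ∧-lowerʳ : (U V : Pred X) → U ∧ V ≤ V
  ∧-lowerʳ U V = ≤-trans (⨾-monoʳ d (⨾-monoˡ l⇒ (⊗-mono (⊤-top U) ≤-refl))) (≤-reflexive (⊤-∧ V))

  ∧-lowerˡ : (U V : Pred X) → U ∧ V ≤ U
  ∧-lowerˡ U V = subst (_≤ U) (∧-comm V U) (∧-lowerʳ V U)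

  ∧-greatest : (U V W : Pred X) → W ≤ U → W ≤ V → W ≤ U ∧ V
  ∧-greatest U V W W≤U W≤V = begin
    W                    ≡⟨ sym (trans (W ⟩⨾ cong (_⨾ l⇒) d-I) (cancelʳ unitˡ-isoʳ)) ⟩
    W ⨾ d ⨾ l⇒           ≡⟨ sym (⨾-assoc _ _ _) ⟩
    (W ⨾ d) ⨾ l⇒         ≤⟨ ⨾-monoˡ l⇒ (lax-d W) ⟩
    (d ⨾ (W ⊗₁ W)) ⨾ l⇒  ≡⟨ ⨾-assoc _ _ _ ⟩
    d ⨾ (W ⊗₁ W) ⨾ l⇒    ≤⟨ ⨾-monoʳ d (⨾-monoˡ l⇒ (⊗-mono W≤U W≤V)) ⟩
    d ⨾ (U ⊗₁ V) ⨾ l⇒    ∎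
    where open ≤-Reasoning

  map-⨾-∧ : {f : Hom X Y} → IsMap f → (U V : Pred Y) → f ⨾ (U ∧ V) ≡ (f ⨾ U) ∧ (f ⨾ V)
  map-⨾-∧ {f = f} map-f U V = begin
    f ⨾ (U ∧ V)                ≡⟨ f ⟩⨾ ∧-pair U V ⟩
    f ⨾ ⟨ U , V ⟩ ⨾ l⇒         ≡⟨ pullˡ (map-⨾-pair map-f U V) ⟩
    ⟨ f ⨾ U , f ⨾ V ⟩ ⨾ l⇒     ≡⟨ sym (∧-pair _ _) ⟩
    (f ⨾ U) ∧ (f ⨾ V)          ∎
    where open ≡-Reasoning

  isInfSLFunctor : Defs.IsInfSLFunctor 𝔹
  isInfSLFunctor = record
    { ⊤-top      = ⊤-top
    ; ∧-lowerˡ   = ∧-lowerˡ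
    ; ∧-lowerʳ   = ∧-lowerʳ
    ; ∧-greatest = ∧-greatest
    ; R₁-⊤       = λ _ → proj₂
    ; R₁-∧       = λ _ → map-⨾-∧
    ; R₁-id      = ⨾-identityˡ
    ; R₁-⨾       = λ f g _ _ → ⨾-assoc f g
    }

  infix 4 _⊣_
  _⊣_ : Hom X Y → Hom Y X → Set r
  f ⊣ g = (id ≤ f ⨾ g) × (g ⨾ f ≤ id)

  iso⇒⊣ : {f : Hom X Y} {g : Hom Y X} → f ⨾ g ≡ id → g ⨾ f ≡ id → f ⊣ g
  iso⇒⊣ fg gf = ≤-reflexive (sym fg) , ≤-reflexive gf

  ⊣-⨾ : {f : Hom X Y} {f° : Hom Y X} {g : Hom Y Z} {g° : Hom Z Y} →
        f ⊣ f° → g ⊣ g° → f ⨾ g ⊣ g° ⨾ f°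
  ⊣-⨾ {f = f} {f°} {g} {g°} (f-unit , f-counit) (g-unit , g-counit) = unit , counit
    where
    open ≤-Reasoning
    unit : id ≤ (f ⨾ g) ⨾ g° ⨾ f°
    unit = begin
      id                  ≤⟨ f-unit ⟩
      f ⨾ f°              ≡⟨ f ⟩⨾ sym (⨾-identityˡ f°) ⟩
      f ⨾ id ⨾ f°         ≤⟨ ⨾-monoʳ f (⨾-monoˡ f° g-unit) ⟩
      f ⨾ (g ⨾ g°) ⨾ f°   ≡⟨ trans (f ⟩⨾ ⨾-assoc g g° f°) (sym (⨾-assoc f g _)) ⟩
      (f ⨾ g) ⨾ g° ⨾ f°   ∎
    counit : (g° ⨾ f°) ⨾ f ⨾ g ≤ id
    counit = begin
      (g° ⨾ f°) ⨾ f ⨾ g   ≡⟨ trans (⨾-assoc g° f° _) (g° ⟩⨾ sym (⨾-assoc f° f g)) ⟩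
      g° ⨾ (f° ⨾ f) ⨾ g   ≤⟨ ⨾-monoʳ g° (⨾-monoˡ g f-counit) ⟩
      g° ⨾ id ⨾ g         ≡⟨ g° ⟩⨾ ⨾-identityˡ g ⟩
      g° ⨾ g              ≤⟨ g-counit ⟩
      id                  ∎

  ⊗-⊣ : {f : Hom A B} {f° : Hom B A} {g : Hom C D} {g° : Hom D C} →
        f ⊣ f° → g ⊣ g° → f ⊗₁ g ⊣ f° ⊗₁ g°
  ⊗-⊣ {f = f} {f°} {g} {g°} (f-unit , f-counit) (g-unit , g-counit) = unit , counit
    where
    open ≤-Reasoning
    unit : id ≤ (f ⊗₁ g) ⨾ (f° ⊗₁ g°)
    unit = begin
      id                       ≡⟨ sym ⊗-identity ⟩
      id ⊗₁ id                 ≤⟨ ⊗-mono f-unit g-unit ⟩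
      (f ⨾ f°) ⊗₁ (g ⨾ g°)     ≡⟨ ⊗-homo f f° g g° ⟩
      (f ⊗₁ g) ⨾ (f° ⊗₁ g°)    ∎
    counit : (f° ⊗₁ g°) ⨾ (f ⊗₁ g) ≤ id
    counit = begin
      (f° ⊗₁ g°) ⨾ (f ⊗₁ g)    ≡⟨ sym (⊗-homo f° f g° g) ⟩
      (f° ⨾ f) ⊗₁ (g° ⨾ g)     ≤⟨ ⊗-mono f-counit g-counit ⟩
      id ⊗₁ id                 ≡⟨ ⊗-identity ⟩
      id                       ∎

  id⊣id : id {X} ⊣ id
  id⊣id = iso⇒⊣ (⨾-identityˡ id) (⨾-identityˡ id)

  ⊣-transpose : {f : Hom X Y} {g : Hom Y X} → f ⊣ g →
                (β : Hom X Z) (α : Hom Y Z) → (g ⨾ β ≤ α) ⇔ (β ≤ f ⨾ α)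
  ⊣-transpose {f = f} {g} (unit , counit) β α = mk⇔ to from
    where
    open ≤-Reasoning
    to : g ⨾ β ≤ α → β ≤ f ⨾ α
    to gβ≤α = begin
      β             ≡⟨ sym (⨾-identityˡ β) ⟩
      id ⨾ β        ≤⟨ ⨾-monoˡ β unit ⟩
      (f ⨾ g) ⨾ β   ≡⟨ ⨾-assoc f g β ⟩
      f ⨾ g ⨾ β     ≤⟨ ⨾-monoʳ f gβ≤α ⟩
      f ⨾ α         ∎
    from : β ≤ f ⨾ α → g ⨾ β ≤ α
    from β≤fα = begin
      g ⨾ β         ≤⟨ ⨾-monoʳ g β≤fα ⟩
      g ⨾ f ⨾ α     ≡⟨ sym (⨾-assoc g f α) ⟩
      (g ⨾ f) ⨾ α   ≤⟨ ⨾-monoˡ α counit ⟩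
      id ⨾ α        ≡⟨ ⨾-identityˡ α ⟩
      α             ∎

  ⊣-mate : {p : Hom X A} {p° : Hom A X} {q : Hom Y B} {q° : Hom B Y} {h : Hom Y X} {k : Hom B A} →
           p ⊣ p° → q ⊣ q° → h ⨾ p ≡ q ⨾ k → q° ⨾ h ≤ k ⨾ p°
  ⊣-mate {p = p} {p°} {q} {q°} {h} {k} (p-unit , _) (_ , q-counit) square = begin
    q° ⨾ h               ≡⟨ sym (⨾-identityʳ _) ⟩
    (q° ⨾ h) ⨾ id        ≤⟨ ⨾-monoʳ _ p-unit ⟩
    (q° ⨾ h) ⨾ p ⨾ p°    ≡⟨ trans (⨾-assoc q° h _) (q° ⟩⨾ pullˡ square) ⟩
    q° ⨾ (q ⨾ k) ⨾ p°    ≡⟨ trans (q° ⟩⨾ ⨾-assoc q k p°) (sym (⨾-assoc q° q _)) ⟩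
    (q° ⨾ q) ⨾ k ⨾ p°    ≤⟨ ⨾-monoˡ _ q-counit ⟩
    id ⨾ k ⨾ p°          ≡⟨ ⨾-identityˡ _ ⟩
    k ⨾ p°               ∎
    where open ≤-Reasoning

  -- One inequality is the mate of the square; for the other, factor u through h by w and
  -- use the mate of the square w ⨾ q = s ⨾ id.
  ⊣-beck-chevalley :
    {p : Hom X A} {p° : Hom A X} {q : Hom Y B} {q° : Hom B Y} {s : Hom Z B} {s° : Hom B Z}
    {h : Hom Y X} {k : Hom B A} {u : Hom Z X} {w : Hom Z Y} →
    p ⊣ p° → q ⊣ q° → s ⊣ s° →
    h ⨾ p ≡ q ⨾ k → k ⨾ p° ≡ s° ⨾ u → w ⨾ h ≡ u → w ⨾ q ≡ s →
    q° ⨾ h ≡ k ⨾ p°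
  ⊣-beck-chevalley {p° = p°} {q° = q°} {s° = s°} {h} {k} {u} {w}
                   p⊣p° q⊣q° s⊣s° square commute wh≡u wq≡s =
    ≤-antisym (⊣-mate p⊣p° q⊣q° square) (begin
      k ⨾ p°        ≡⟨ commute ⟩
      s° ⨾ u        ≡⟨ s° ⟩⨾ sym wh≡u ⟩
      s° ⨾ w ⨾ h    ≡⟨ sym (⨾-assoc s° w h) ⟩
      (s° ⨾ w) ⨾ h  ≤⟨ ⨾-monoˡ h (⊣-mate q⊣q° s⊣s° (trans wq≡s (sym (⨾-identityʳ _)))) ⟩
      (id ⨾ q°) ⨾ h ≡⟨ cong (_⨾ h) (⨾-identityˡ q°) ⟩
      q° ⨾ h        ∎)
    where open ≤-Reasoning

  -- Existential quantification along projections

  π₁° : Hom X (X ⊗₀ Y)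
  π₁° = r⇐ ⨾ (id ⊗₁ e*)

  π₂° : Hom Y (X ⊗₀ Y)
  π₂° = l⇐ ⨾ (e* ⊗₁ id)

  π₁⊣π₁° : π₁ {X} {Y} ⊣ π₁°
  π₁⊣π₁° = ⊣-⨾ (⊗-⊣ id⊣id (e-unit , e-counit)) (iso⇒⊣ unitʳ-isoˡ unitʳ-isoʳ)

  π₂⊣π₂° : π₂ {X} {Y} ⊣ π₂°
  π₂⊣π₂° = ⊣-⨾ (⊗-⊣ (e-unit , e-counit) id⊣id) (iso⇒⊣ unitˡ-isoˡ unitˡ-isoʳ)

  π₁-natural : (f : Hom A B) → (f ⊗₁ id {X}) ⨾ π₁ ≡ π₁ ⨾ f
  π₁-natural f =
    trans (replaceˡ (sym (⊗-interchange f e)))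
    (trans ((id ⊗₁ e) ⟩⨾ unitʳ-natural f) (sym (⨾-assoc _ _ _)))

  π₂-natural : (f : Hom A B) → (id {X} ⊗₁ f) ⨾ π₂ ≡ π₂ ⨾ f
  π₂-natural f =
    trans (replaceˡ (⊗-interchange e f))
    (trans ((e ⊗₁ id) ⟩⨾ unitˡ-natural f) (sym (⨾-assoc _ _ _)))

  π₁°-natural : (f : Hom A B) → f ⨾ π₁° {Y = X} ≡ π₁° ⨾ (f ⊗₁ id)
  π₁°-natural f =
    trans (replaceˡ (unitʳ⇐-natural f))
    (trans (r⇐ ⟩⨾ sym (⊗-interchange f e*)) (sym (⨾-assoc _ _ _)))

  π₂°-natural : (f : Hom A B) → f ⨾ π₂° {X = X} ≡ π₂° ⨾ (id ⊗₁ f)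
  π₂°-natural f =
    trans (replaceˡ (unitˡ⇐-natural f))
    (trans (l⇐ ⟩⨾ ⊗-interchange e* f) (sym (⨾-assoc _ _ _)))

  π₁°-pair : π₁° {A} {X} ⨾ ⟨ π₁ , id ⟩ ≡ ⟨ id , π₁° ⟩
  π₁°-pair = begin
    π₁° ⨾ ⟨ π₁ , id ⟩
      ≡⟨ π₁° ⟩⨾ pair-π₁-id ⟩
    (r⇐ ⨾ (id ⊗₁ e*)) ⨾ (d ⊗₁ id) ⨾ a⇒
      ≡⟨ trans (⨾-assoc _ _ _) (r⇐ ⟩⨾ replaceˡ (⊗-interchange d e*)) ⟩
    r⇐ ⨾ (d ⊗₁ id) ⨾ (id ⊗₁ e*) ⨾ a⇒
      ≡⟨ replaceˡ (sym (unitʳ⇐-natural d)) ⟩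
    d ⨾ r⇐ ⨾ (id ⊗₁ e*) ⨾ a⇒
      ≡⟨ d ⟩⨾ r⇐ ⟩⨾ cong (λ z → (z ⊗₁ e*) ⨾ a⇒) (sym ⊗-identity) ⟩
    d ⨾ r⇐ ⨾ ((id ⊗₁ id) ⊗₁ e*) ⨾ a⇒
      ≡⟨ d ⟩⨾ r⇐ ⟩⨾ assoc-natural id id e* ⟩
    d ⨾ r⇐ ⨾ a⇒ ⨾ (id ⊗₁ (id ⊗₁ e*))
      ≡⟨ d ⟩⨾ pullˡ unitʳ⇐-assoc ⟩
    d ⨾ (id ⊗₁ r⇐) ⨾ (id ⊗₁ (id ⊗₁ e*))
      ≡⟨ d ⟩⨾ sym (id⊗-homo r⇐ (id ⊗₁ e*)) ⟩
    ⟨ id , π₁° ⟩ ∎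
    where open ≡-Reasoning

  π₂°-pair : π₂° {X} {A} ⨾ ⟨ π₂ , id ⟩ ≡ ⟨ id , π₂° ⟩
  π₂°-pair = begin
    π₂° ⨾ ⟨ π₂ , id ⟩
      ≡⟨ π₂° ⟩⨾ pair-π₂-id ⟩
    (l⇐ ⨾ (e* ⊗₁ id)) ⨾ (id ⊗₁ d) ⨾ exchange
      ≡⟨ trans (⨾-assoc _ _ _) (l⇐ ⟩⨾ replaceˡ (sym (⊗-interchange e* d))) ⟩
    l⇐ ⨾ (id ⊗₁ d) ⨾ (e* ⊗₁ id) ⨾ exchange
      ≡⟨ replaceˡ (sym (unitˡ⇐-natural d)) ⟩
    d ⨾ l⇐ ⨾ (e* ⊗₁ id) ⨾ a⇐ ⨾ (σ ⊗₁ id) ⨾ a⇒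
      ≡⟨ d ⟩⨾ l⇐ ⟩⨾ cong (λ z → (e* ⊗₁ z) ⨾ a⇐ ⨾ (σ ⊗₁ id) ⨾ a⇒) (sym ⊗-identity) ⟩
    d ⨾ l⇐ ⨾ (e* ⊗₁ (id ⊗₁ id)) ⨾ a⇐ ⨾ (σ ⊗₁ id) ⨾ a⇒
      ≡⟨ d ⟩⨾ l⇐ ⟩⨾ replaceˡ (assoc⇐-natural e* id id) ⟩
    d ⨾ l⇐ ⨾ a⇐ ⨾ ((e* ⊗₁ id) ⊗₁ id) ⨾ (σ ⊗₁ id) ⨾ a⇒
      ≡⟨ d ⟩⨾ pullˡ unitˡ⇐-assoc⇐ ⟩
    d ⨾ (l⇐ ⊗₁ id) ⨾ ((e* ⊗₁ id) ⊗₁ id) ⨾ (σ ⊗₁ id) ⨾ a⇒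
      ≡⟨ d ⟩⨾ (l⇐ ⊗₁ id) ⟩⨾ pullˡ (sym (⊗id-homo (e* ⊗₁ id) σ)) ⟩
    d ⨾ (l⇐ ⊗₁ id) ⨾ (((e* ⊗₁ id) ⨾ σ) ⊗₁ id) ⨾ a⇒
      ≡⟨ d ⟩⨾ pullˡ (sym (⊗id-homo l⇐ ((e* ⊗₁ id) ⨾ σ))) ⟩
    d ⨾ ((l⇐ ⨾ (e* ⊗₁ id) ⨾ σ) ⊗₁ id) ⨾ a⇒
      ≡⟨ d ⟩⨾ cong (λ z → (z ⊗₁ id) ⨾ a⇒) (trans (l⇐ ⟩⨾ σ-natural e* id) (pullˡ unitˡ⇐-σ)) ⟩
    d ⨾ ((r⇐ ⨾ (id ⊗₁ e*)) ⊗₁ id) ⨾ a⇒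
      ≡⟨ d ⟩⨾ pushˡ (⊗id-homo r⇐ (id ⊗₁ e*)) ⟩
    d ⨾ (r⇐ ⊗₁ id) ⨾ ((id ⊗₁ e*) ⊗₁ id) ⨾ a⇒
      ≡⟨ d ⟩⨾ (r⇐ ⊗₁ id) ⟩⨾ assoc-natural id e* id ⟩
    d ⨾ (r⇐ ⊗₁ id) ⨾ a⇒ ⨾ (id ⊗₁ (e* ⊗₁ id))
      ≡⟨ d ⟩⨾ pullˡ unitʳ⇐⊗id-assoc ⟩
    d ⨾ (id ⊗₁ l⇐) ⨾ (id ⊗₁ (e* ⊗₁ id))
      ≡⟨ d ⟩⨾ sym (id⊗-homo l⇐ (e* ⊗₁ id)) ⟩
    ⟨ id , π₂° ⟩ ∎
    where open ≡-Reasoning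

  frobenius-reciprocity : {p : Hom X A} {p° : Hom A X} → p° ⨾ ⟨ p , id ⟩ ≡ ⟨ id , p° ⟩ →
                          (α : Pred A) (β : Pred X) → p° ⨾ ((p ⨾ α) ∧ β) ≡ α ∧ (p° ⨾ β)
  frobenius-reciprocity {p = p} {p°} p°-pair α β = begin
    p° ⨾ ((p ⨾ α) ∧ β)
      ≡⟨ p° ⟩⨾ trans (∧-pair _ _) (cong (λ z → ⟨ p ⨾ α , z ⟩ ⨾ l⇒) (sym (⨾-identityˡ β))) ⟩
    p° ⨾ ⟨ p ⨾ α , id ⨾ β ⟩ ⨾ l⇒
      ≡⟨ p° ⟩⨾ cong (_⨾ l⇒) (sym (pair-⨾-⊗ p id α β)) ⟩
    p° ⨾ (⟨ p , id ⟩ ⨾ (α ⊗₁ β)) ⨾ l⇒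
      ≡⟨ pullˡ (pullˡ p°-pair) ⟩
    (⟨ id , p° ⟩ ⨾ (α ⊗₁ β)) ⨾ l⇒
      ≡⟨ cong (_⨾ l⇒) (pair-⨾-⊗ id p° α β) ⟩
    ⟨ id ⨾ α , p° ⨾ β ⟩ ⨾ l⇒
      ≡⟨ sym (∧-pair _ _) ⟩
    (id ⨾ α) ∧ (p° ⨾ β)
      ≡⟨ cong (_∧ (p° ⨾ β)) (⨾-identityˡ α) ⟩
    α ∧ (p° ⨾ β) ∎
    where open ≡-Reasoning

  IsPullback : Hom D B → Hom D C → Hom B A → Hom C A → Set (o ⊔ ℓ)
  IsPullback = Defs.IsPullback 𝔹

  beck-chevalley₁ : (f : Hom A' A) (f' : Hom (A' ⊗₀ X') (A ⊗₀ X)) →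
                    IsMap f → IsPullback f' π₁ π₁ f → π₁° ⨾ f' ≡ f ⨾ π₁°
  beck-chevalley₁ f f' map-f (square , universal)
    with universal (f ⊗₁ id) π₁ (map-⊗ map-f map-id) map-π₁ (π₁-natural f)
  ... | _ , _ , w⨾f'≡f⊗id , w⨾π₁≡π₁ , _ =
    ⊣-beck-chevalley π₁⊣π₁° π₁⊣π₁° π₁⊣π₁° square (π₁°-natural f) w⨾f'≡f⊗id w⨾π₁≡π₁

  beck-chevalley₂ : (f : Hom A' A) (f' : Hom (X' ⊗₀ A') (X ⊗₀ A)) →
                    IsMap f → IsPullback f' π₂ π₂ f → π₂° ⨾ f' ≡ f ⨾ π₂°
  beck-chevalley₂ f f' map-f (square , universal)
    with universal (id ⊗₁ f) π₂ (map-⊗ map-id map-f) map-π₂ (π₂-natural f)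
  ... | _ , _ , w⨾f'≡id⊗f , w⨾π₂≡π₂ , _ =
    ⊣-beck-chevalley π₂⊣π₂° π₂⊣π₂° π₂⊣π₂° square (π₂°-natural f) w⨾f'≡id⊗f w⨾π₂≡π₂

  isExistential : Defs.IsExistential 𝔹
  isExistential = record
    { ∃₁     = π₁° ⨾_
    ; ∃₂     = π₂° ⨾_
    ; ∃₁-adj = ⊣-transpose π₁⊣π₁°
    ; ∃₂-adj = ⊣-transpose π₂⊣π₂°
    ; BC₂    = λ f f' map-f _ pullback β →
                 trans (pullˡ (beck-chevalley₂ f f' map-f pullback)) (⨾-assoc _ _ β)
    ; BC₁    = λ f f' map-f _ pullback β →
                 trans (pullˡ (beck-chevalley₁ f f' map-f pullback)) (⨾-assoc _ _ β)
    ; FR₂    = frobenius-reciprocity π₂°-pair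
    ; FR₁    = frobenius-reciprocity π₁°-pair
    }

  -- Equality

  _×₁_ : Hom A B → Hom C D → Hom (A ⊗₀ C) (B ⊗₀ D)
  _×₁_ = Defs._×₁_ 𝔹

  ×₁≡⊗₁ : (h : Hom A C) (k : Hom B D) → h ×₁ k ≡ h ⊗₁ k
  ×₁≡⊗₁ h k =
    trans (sym (pair-⨾-⊗ π₁ π₂ h k)) (trans (cong (_⨾ (h ⊗₁ k)) pair-π₁-π₂) (⨾-identityˡ _))

  δ : (A : Obj) → Pred (A ⊗₀ A)
  δ A = d* ⨾ e

  frobenius-δ : (d {A} ⊗₁ id) ⨾ a⇒ ⨾ (id ⊗₁ δ A) ≡ d* ⨾ r⇐
  frobenius-δ = begin
    (d ⊗₁ id) ⨾ a⇒ ⨾ (id ⊗₁ (d* ⨾ e))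
      ≡⟨ (d ⊗₁ id) ⟩⨾ a⇒ ⟩⨾ id⊗-homo d* e ⟩
    (d ⊗₁ id) ⨾ a⇒ ⨾ (id ⊗₁ d*) ⨾ (id ⊗₁ e)
      ≡⟨ sym (trans (⨾-assoc _ _ _) ((d ⊗₁ id) ⟩⨾ ⨾-assoc _ _ _)) ⟩
    ((d ⊗₁ id) ⨾ a⇒ ⨾ (id ⊗₁ d*)) ⨾ (id ⊗₁ e)
      ≡⟨ cong (_⨾ (id ⊗₁ e)) frobenius ⟩
    (d* ⨾ d) ⨾ (id ⊗₁ e)
      ≡⟨ trans (⨾-assoc _ _ _) (d* ⟩⨾ d-counitʳ⇐) ⟩
    d* ⨾ r⇐ ∎
    where open ≡-Reasoning

  unitʳ⇐-⊗id-unitˡ : (U : Pred X) → r⇐ ⨾ (U ⊗₁ id) ⨾ l⇒ ≡ U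
  unitʳ⇐-⊗id-unitˡ U =
    trans (r⇐ ⟩⨾ (U ⊗₁ id) ⟩⨾ sym unitʳ≡unitˡ) (trans (r⇐ ⟩⨾ unitʳ-natural U) (cancelˡ unitʳ-isoʳ))

  -- The Frobenius law lets δ absorb the copy of the A-component made by the meet.
  equality-∧ : (γ : Pred (X ⊗₀ A)) → ((id ⊗₁ π₁) ⨾ γ) ∧ (π₂ ⨾ δ A) ≡ (id ⊗₁ d*) ⨾ γ
  equality-∧ {X = X} {A = A} γ = begin
    ((id ⊗₁ π₁) ⨾ γ) ∧ (π₂ ⨾ δ A)
      ≡⟨ ∧-pair _ _ ⟩
    ⟨ (id ⊗₁ π₁) ⨾ γ , π₂ ⨾ δ A ⟩ ⨾ l⇒
      ≡⟨ cong (_⨾ l⇒) (sym (pair-⨾-⊗ _ _ γ (δ A))) ⟩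
    (⟨ id ⊗₁ π₁ , π₂ ⟩ ⨾ (γ ⊗₁ δ A)) ⨾ l⇒
      ≡⟨ cong (λ z → (z ⨾ (γ ⊗₁ δ A)) ⨾ l⇒) copy ⟩
    (((id ⊗₁ c) ⨾ a⇐) ⨾ (γ ⊗₁ δ A)) ⨾ l⇒
      ≡⟨ cong (_⨾ l⇒) (trans (⨾-assoc _ _ _) ((id ⊗₁ c) ⟩⨾ split)) ⟩
    ((id ⊗₁ c) ⨾ (id ⊗₁ (id ⊗₁ δ A)) ⨾ a⇐ ⨾ (γ ⊗₁ id)) ⨾ l⇒
      ≡⟨ cong (_⨾ l⇒) (pullˡ absorb) ⟩
    (((id ⊗₁ d*) ⨾ (id ⊗₁ r⇐)) ⨾ a⇐ ⨾ (γ ⊗₁ id)) ⨾ l⇒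
      ≡⟨ cong (_⨾ l⇒) (trans (⨾-assoc _ _ _) ((id ⊗₁ d*) ⟩⨾ pullˡ id⊗unitʳ⇐-assoc⇐)) ⟩
    ((id ⊗₁ d*) ⨾ r⇐ ⨾ (γ ⊗₁ id)) ⨾ l⇒
      ≡⟨ trans (⨾-assoc _ _ _) ((id ⊗₁ d*) ⟩⨾ ⨾-assoc _ _ _) ⟩
    (id ⊗₁ d*) ⨾ r⇐ ⨾ (γ ⊗₁ id) ⨾ l⇒
      ≡⟨ (id ⊗₁ d*) ⟩⨾ unitʳ⇐-⊗id-unitˡ γ ⟩
    (id ⊗₁ d*) ⨾ γ ∎
    where
    open ≡-Reasoning
    c : Hom (A ⊗₀ A) (A ⊗₀ (A ⊗₀ A))
    c = (d ⊗₁ id) ⨾ a⇒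
    copy : ⟨ id {X} ⊗₁ π₁ , π₂ ⟩ ≡ (id ⊗₁ c) ⨾ a⇐
    copy = trans (pair-id⊗-π₂ π₁) (cong (λ z → (id ⊗₁ z) ⨾ a⇐) pair-π₁-id)
    split : a⇐ ⨾ (γ ⊗₁ δ A) ≡ (id ⊗₁ (id ⊗₁ δ A)) ⨾ a⇐ ⨾ (γ ⊗₁ id)
    split = begin
      a⇐ ⨾ (γ ⊗₁ δ A)
        ≡⟨ a⇐ ⟩⨾ ⊗-splitʳ γ (δ A) ⟩
      a⇐ ⨾ (id ⊗₁ δ A) ⨾ (γ ⊗₁ id)
        ≡⟨ a⇐ ⟩⨾ cong (λ z → (z ⊗₁ δ A) ⨾ (γ ⊗₁ id)) (sym ⊗-identity) ⟩
      a⇐ ⨾ ((id ⊗₁ id) ⊗₁ δ A) ⨾ (γ ⊗₁ id)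
        ≡⟨ replaceˡ (sym (assoc⇐-natural id id (δ A))) ⟩
      (id ⊗₁ (id ⊗₁ δ A)) ⨾ a⇐ ⨾ (γ ⊗₁ id) ∎
    absorb : (id ⊗₁ c) ⨾ (id ⊗₁ (id ⊗₁ δ A)) ≡ (id ⊗₁ d*) ⨾ (id ⊗₁ r⇐)
    absorb = begin
      (id ⊗₁ c) ⨾ (id ⊗₁ (id ⊗₁ δ A))  ≡⟨ sym (id⊗-homo c (id ⊗₁ δ A)) ⟩
      id ⊗₁ (c ⨾ (id ⊗₁ δ A))          ≡⟨ cong (id ⊗₁_) (trans (⨾-assoc _ _ _) frobenius-δ) ⟩
      id ⊗₁ (d* ⨾ r⇐)                  ≡⟨ id⊗-homo d* r⇐ ⟩
      (id ⊗₁ d*) ⨾ (id ⊗₁ r⇐)          ∎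

  isElementary : Defs.IsElementary 𝔹
  isElementary = δ , λ α β →
    subst₂ (λ γ h → (γ ≤ β) ⇔ (α ≤ h ⨾ β)) (sym (equality-∃ α)) (sym id×Δ≡id⊗d)
      (⊣-transpose (⊗-⊣ id⊣id (d-unit , d-counit)) α β)
    where
    id×Δ≡id⊗d : id {X} ×₁ Defs.Δ 𝔹 {A} ≡ id ⊗₁ d
    id×Δ≡id⊗d = trans (×₁≡⊗₁ id _) (cong (id ⊗₁_) pair-id-id)
    pair-π₁-π₂π₁ : ⟨ π₁ {X} , π₂ ⨾ π₁ {A} {A} ⟩ ≡ id ⊗₁ π₁
    pair-π₁-π₂π₁ = trans (cong ⟨_, π₂ ⨾ π₁ ⟩ (sym (⨾-identityʳ π₁))) (×₁≡⊗₁ id π₁)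
    pair-π₂π₁-π₂π₂ : ⟨ π₂ ⨾ π₁ , π₂ ⨾ π₂ ⟩ ≡ π₂ {X} {A ⊗₀ A}
    pair-π₂π₁-π₂π₂ =
      trans (sym (map-⨾-pair map-π₂ π₁ π₂)) (trans (π₂ ⟩⨾ pair-π₁-π₂) (⨾-identityʳ π₂))
    equality-∃ : (α : Pred (X ⊗₀ A)) →
                 (⟨ π₁ , π₂ ⨾ π₁ ⟩ ⨾ α) ∧ (⟨ π₂ ⨾ π₁ , π₂ ⨾ π₂ ⟩ ⨾ δ A) ≡ (id ⊗₁ d*) ⨾ α
    equality-∃ α =
      trans (cong₂ (λ u v → (u ⨾ α) ∧ (v ⨾ δ _)) pair-π₁-π₂π₁ pair-π₂π₁-π₂π₂) (equality-∧ α)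

theorem5p1 : ∀ {o ℓ r : Level} (𝔹 : CartesianBicategory o ℓ r) →
    IsElementaryExistentialDoctrine 𝔹
theorem5p1 𝔹 = record
  { isInfSLFunctor = isInfSLFunctor
  ; elementary     = isElementary
  ; existential    = isExistential
  }
  where open Properties 𝔹
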